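{- Let $T$ be a tree with a perfect matching and let $n$ be a positive integer. The following are equivalent: (1) $P_n\square T$ is Hamiltonian; (2) $P_n\square T$ is $1$-tough; (3) $n\geq \Delta(T)$.
   Context: All graphs are finite and simple. $P_n$ is the path with $n$ vertices, $\Delta(G)$ the maximum degree. A graph is Hamiltonian if it has a spanning cycle. The Cartesian product $G_1\square G_2$ has vertex set $\{v_u : v\in V(G_1), u\in V(G_2)\}$, with $v_u v_w$ an edge whenever $uw\in E(G_2)$, and $v_u w_u$ an edge whenever $vw\in E(G_1)$. For $S\subseteq V(G)$, $G-S$ is the subgraph induced on $V(G)\setminus S$ and $c(G-S)$ its number of components. A graph $G$ is $t$-tough if $|S|\geq t\cdot c(G-S)$ for every $S\subseteq V(G)$ with $c(G-S)\geq 2$ (so complete graphs are $t$-tough for every $t$). -}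

module Defs where

open import Data.Nat using (ℕ; zero; suc; _≤_; _⊔_)
open import Data.Bool using (Bool; true; false; _∧_; _∨_; not)
open import Data.Fin using (Fin; toℕ; remQuot; _≟_)
open import Data.Fin.Subset using (Subset; ∣_∣)
open import Data.Vec using (lookup; tabulate)
open import Data.List using (List; []; _∷_; _++_; length; foldr; map; allFin)
open import Data.List.Membership.Propositional using (_∈_)
open import Data.List.Relation.Unary.Unique.Propositional using (Unique)
open import Data.Product using (_×_; _,_; ∃; Σ)
open import Data.Unit using (⊤)
open import Relation.Nullary using (¬_; ⌊_⌋)
open import Relation.Binary.PropositionalEquality using (_≡_; _≢_)

Graph : ℕ → Set
Graph n = Fin n → Fin n → Bool

IsSimple : ∀ {n} → Graph n → Set
IsSimple {n} G = (∀ (u v : Fin n) → G u v ≡ G v u) × (∀ (u : Fin n) → G u u ≡ false)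

data Walk {n} (G : Graph n) : Fin n → Fin n → Set where
  [] : ∀ {u} → Walk G u u
  _∷_ : ∀ {u v w} → G u v ≡ true → Walk G v w → Walk G u w

Connected : ∀ {n} → Graph n → Set
Connected {n} G = ∀ (u v : Fin n) → Walk G u v

Chain : ∀ {n} → Graph n → List (Fin n) → Set
Chain G [] = ⊤
Chain G (x ∷ []) = ⊤
Chain G (x ∷ y ∷ xs) = (G x y ≡ true) × Chain G (y ∷ xs)

CyclicChain : ∀ {n} → Graph n → List (Fin n) → Set
CyclicChain G [] = ⊤
CyclicChain G (x ∷ xs) = Chain G (x ∷ xs ++ (x ∷ []))

IsCycle : ∀ {n} → Graph n → List (Fin n) → Set
IsCycle G xs = Unique xs × (3 ≤ length xs) × CyclicChain G xs

Acyclic : ∀ {n} → Graph n → Set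
Acyclic G = ∀ xs → ¬ IsCycle G xs

IsTree : ∀ {n} → Graph n → Set
IsTree {n} G = (1 ≤ n) × Connected G × Acyclic G

-- perfect matching: each vertex v matched to exactly one adjacent vertex mate v,
-- given as a fixed-point-free involution along edges
HasPerfectMatching : ∀ {n} → Graph n → Set
HasPerfectMatching {n} G =
  Σ (Fin n → Fin n) λ mate → (∀ v → G v (mate v) ≡ true) × (∀ v → mate (mate v) ≡ v)

-- Hamiltonian: a cyclic ordering of all vertices (each exactly once) with
-- cyclically consecutive vertices adjacent.  Convention: length ≥ 2, so K₂ counts
--.
Hamiltonian : ∀ {n} → Graph n → Set
Hamiltonian {n} G =
  ∃ λ (xs : List (Fin n)) → Unique xs × (2 ≤ length xs) × (∀ v → v ∈ xs) × CyclicChain G xs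

degree : ∀ {n} → Graph n → Fin n → ℕ
degree G v = ∣ tabulate (G v) ∣

maxDegree : ∀ {n} → Graph n → ℕ
maxDegree {n} G = foldr _⊔_ 0 (map (degree G) (allFin n))

PathGraph : (n : ℕ) → Graph n
PathGraph n i j = ⌊ toℕ i Data.Nat.≟ suc (toℕ j) ⌋ ∨ ⌊ toℕ j Data.Nat.≟ suc (toℕ i) ⌋

-- Cartesian product; vertex v_u (v ∈ G₁, u ∈ G₂) is encoded by combine v u, decoded by remQuot
_□_ : ∀ {a b} → Graph a → Graph b → Graph (a Data.Nat.* b)
_□_ {a} {b} G₁ G₂ x y with remQuot b x | remQuot b y
... | (v , u) | (w , u′) = (⌊ v ≟ w ⌋ ∧ G₂ u u′) ∨ (⌊ u ≟ u′ ⌋ ∧ G₁ v w)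

-- G - S (vertices of S isolated and excluded; walks between vertices outside S)
delete : ∀ {n} → Graph n → Subset n → Graph n
delete G S u v = G u v ∧ not (lookup S u) ∧ not (lookup S v)

-- c(G - S) = k : there are k representatives outside S, pairwise in different
-- components of G - S, and every vertex outside S is in the component of one of them
NumComponents : ∀ {n} → Graph n → Subset n → ℕ → Set
NumComponents {n} G S k =
  Σ (Fin k → Fin n) λ rep →
    (∀ i → lookup S (rep i) ≡ false)
    × (∀ i j → i ≢ j → ¬ Walk (delete G S) (rep i) (rep j))
    × (∀ v → lookup S v ≡ false → ∃ λ i → Walk (delete G S) (rep i) v)

OneTough : ∀ {n} → Graph n → Set
OneTough {n} G = ∀ (S : Subset n) (k : ℕ) → NumComponents G S k → 2 ≤ k → k ≤ ∣ S ∣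

module Submission where

-- (1 ⇒ 2) holds for every graph: cut the Hamiltonian cycle open after a vertex
--   of S and charge each component of G - S to the next vertex of S on the path.
-- (2 ⇒ 3) Deleting the column {v_u : v ∈ P_n} of a vertex u leaves at least
--   deg(u) components, one through each neighbour of u, because two neighbours
--   joined avoiding u would close a cycle of the tree.
-- (3 ⇒ 1) Grow a cycle column pair by column pair, starting around the columns
--   of a matched pair.  A missing pair w, mate w with w adjacent to a covered u
--   is attached by replacing a rung (i_u, (i+1)_u) of the cycle by a ladder
--   through both columns.  Each attached neighbour of u costs one of the n - 1
--   rungs of u; as w and the mate of u are further neighbours, deg(u) ≤ n
--   always leaves a free rung.

open import Defs
open import Data.Nat as ℕ using (ℕ; zero; suc; _+_; _*_; _≤_; _<_; z≤n; s≤s)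
import Data.Nat.Properties as ℕₚ
open import Data.Bool as Bool using (Bool; true; false; not; _∧_; _∨_; if_then_else_)
open import Data.Bool.Properties using (∧-conicalˡ; ∧-conicalʳ; ∧-zeroʳ; ∨-comm; ∨-zeroʳ)
open import Data.Fin using (Fin; zero; suc; _≟_; toℕ; fromℕ; fromℕ<; inject₁; combine; remQuot)
import Data.Fin.Properties as Finₚ
open import Data.Fin.Properties using (remQuot-combine; combine-remQuot; suc-injective; toℕ-inject₁; inject₁-injective)
open import Data.Fin.Subset using (Subset; ∣_∣)
open import Data.Fin.Subset.Properties using (∣p∣≤n)
open import Data.Vec as Vec using (tabulate)
open import Data.Vec.Properties using (lookup∘tabulate; tabulate∘lookup)
open import Data.List as List using (List; []; _∷_; _++_; [_]; length; map; reverse; filter; allFin)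
open import Data.List.Properties using (++-assoc; ++-identityʳ; unfold-reverse; reverse-involutive; length-++; length-map; length-reverse; length-tabulate; map-++; filter-all; filter-accept; filter-reject; foldr-forcesᵇ; foldr-preservesᵇ)
open import Data.List.Membership.Propositional using (_∈_; _∉_; find)
open import Data.List.Membership.Propositional.Properties using (∈-++⁺ˡ; ∈-++⁺ʳ; ∈-++⁻; ∈-map⁺; ∈-map⁻; ∈-∃++; ∈-allFin; ∈-filter⁺; ∈-filter⁻; ∈-lookup)
import Data.List.Membership.DecPropositional as DecMembership
open import Data.List.Relation.Unary.Any as Any using (here; there)
import Data.List.Relation.Unary.Any.Properties as Anyₚ
import Data.List.Relation.Unary.All as All
open import Data.List.Relation.Unary.All.Properties using (tabulate⁺) renaming (map⁺ to All-map⁺)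
open import Data.List.Relation.Unary.AllPairs using ([]; _∷_)
open import Data.List.Relation.Unary.Unique.Propositional using (Unique)
open import Data.List.Relation.Unary.Unique.Propositional.Properties using (++⁺; map⁺; filter⁺; allFin⁺; Unique[x∷xs]⇒x∉xs)
open import Data.List.Relation.Binary.Disjoint.Propositional using (Disjoint)
open import Data.Product using (_×_; _,_; ∃; ∃₂; Σ; proj₁; proj₂)
open import Data.Sum using (_⊎_; inj₁; inj₂)
open import Data.Empty using (⊥; ⊥-elim)
open import Function using (case_of_)
open import Relation.Nullary using (¬_; Dec; yes; no; ¬?; ⌊_⌋)
open import Relation.Nullary.Decidable using (isYes≗does; dec-true; dec-false)
open import Relation.Binary.PropositionalEquality using (_≡_; _≢_; refl; sym; trans; cong; cong₂; subst; subst₂; module ≡-Reasoning)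

false≢true : ∀ {b} → b ≡ false → b ≡ true → ⊥
false≢true refl ()

module _ {A : Set} (_≟ᴬ_ : (a b : A) → Dec (a ≡ b)) where

  ⌊≟⌋-yes : ∀ {a b} → a ≡ b → ⌊ a ≟ᴬ b ⌋ ≡ true
  ⌊≟⌋-yes {a} {b} e = trans (isYes≗does (a ≟ᴬ b)) (dec-true (a ≟ᴬ b) e)

  ⌊≟⌋-no : ∀ {a b} → a ≢ b → ⌊ a ≟ᴬ b ⌋ ≡ false
  ⌊≟⌋-no {a} {b} ne = trans (isYes≗does (a ≟ᴬ b)) (dec-false (a ≟ᴬ b) ne)

  ⌊≟⌋-sym : ∀ a b → ⌊ a ≟ᴬ b ⌋ ≡ ⌊ b ≟ᴬ a ⌋
  ⌊≟⌋-sym a b with a ≟ᴬ b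
  ... | yes refl = sym (⌊≟⌋-yes refl)
  ... | no a≢b = sym (⌊≟⌋-no (λ e → a≢b (sym e)))

-- Positions in a list.  A cycle of a graph is represented by a list read
-- cyclically, so the basic relations are "y directly follows x", "x is the
-- last entry" and "x is the first entry".
module _ {A : Set} where

  data Consec : List A → A → A → Set where
    chere  : ∀ {x y xs} → Consec (x ∷ y ∷ xs) x y
    cthere : ∀ {x y z xs} → Consec xs x y → Consec (z ∷ xs) x y

  data Last : List A → A → Set where
    lhere  : ∀ {x} → Last (x ∷ []) x
    lthere : ∀ {x y xs} → Last xs x → Last (y ∷ xs) x

  data Head : List A → A → Set where
    hhere : ∀ {x xs} → Head (x ∷ xs) x

  CycAdj : List A → A → A → Set
  CycAdj xs x y = Consec xs x y ⊎ (Last xs x × Head xs y)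

  head-unique : ∀ {xs x y} → Head xs x → Head xs y → x ≡ y
  head-unique hhere hhere = refl

  last-unique : ∀ {xs x y} → Last xs x → Last xs y → x ≡ y
  last-unique lhere lhere = refl
  last-unique (lthere l) (lthere l') = last-unique l l'

  consec-∈₁ : ∀ {xs x y} → Consec xs x y → x ∈ xs
  consec-∈₁ chere = here refl
  consec-∈₁ (cthere c) = there (consec-∈₁ c)

  consec-∈₂ : ∀ {xs x y} → Consec xs x y → y ∈ xs
  consec-∈₂ chere = there (here refl)
  consec-∈₂ (cthere c) = there (consec-∈₂ c)

  consec-++⁻ : ∀ xs ys {x y} → Consec (xs ++ ys) x y →
    Consec xs x y ⊎ Consec ys x y ⊎ (Last xs x × Head ys y)
  consec-++⁻ [] ys c = inj₂ (inj₁ c)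
  consec-++⁻ (z ∷ []) ys chere = inj₂ (inj₂ (lhere , hhere))
  consec-++⁻ (z ∷ []) ys (cthere c) = inj₂ (inj₁ c)
  consec-++⁻ (z ∷ z' ∷ xs) ys chere = inj₁ chere
  consec-++⁻ (z ∷ z' ∷ xs) ys (cthere c) with consec-++⁻ (z' ∷ xs) ys c
  ... | inj₁ c' = inj₁ (cthere c')
  ... | inj₂ (inj₁ c') = inj₂ (inj₁ c')
  ... | inj₂ (inj₂ (l , h)) = inj₂ (inj₂ (lthere l , h))

  consec-++ˡ : ∀ {xs} ys {x y} → Consec xs x y → Consec (xs ++ ys) x y
  consec-++ˡ ys chere = chere
  consec-++ˡ ys (cthere c) = cthere (consec-++ˡ ys c)

  consec-++ʳ : ∀ xs {ys x y} → Consec ys x y → Consec (xs ++ ys) x y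
  consec-++ʳ [] c = c
  consec-++ʳ (z ∷ xs) c = cthere (consec-++ʳ xs c)

  consec-join : ∀ {xs ys x y} → Last xs x → Head ys y → Consec (xs ++ ys) x y
  consec-join lhere hhere = chere
  consec-join (lthere l) h = cthere (consec-join l h)

  last-++ʳ : ∀ xs {ys x} → Last ys x → Last (xs ++ ys) x
  last-++ʳ [] l = l
  last-++ʳ (z ∷ xs) l = lthere (last-++ʳ xs l)

  last-++⁻ : ∀ xs {ys x y} → Head ys y → Last (xs ++ ys) x → Last ys x
  last-++⁻ [] h l = l
  last-++⁻ (z ∷ []) hhere (lthere l) = l
  last-++⁻ (z ∷ z' ∷ xs) h (lthere l) = last-++⁻ (z' ∷ xs) h l

  last-snoc : ∀ xs {x} → Last (xs ++ [ x ]) x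
  last-snoc [] = lhere
  last-snoc (z ∷ xs) = lthere (last-snoc xs)

  head-++ : ∀ {xs} ys {x} → Head xs x → Head (xs ++ ys) x
  head-++ ys hhere = hhere

  rotate-consec : ∀ xs ys {x y} → Consec (ys ++ xs) x y → CycAdj (xs ++ ys) x y
  rotate-consec xs ys c with consec-++⁻ ys xs c
  ... | inj₁ c' = inj₁ (consec-++ʳ xs c')
  ... | inj₂ (inj₁ c') = inj₁ (consec-++ˡ ys c')
  ... | inj₂ (inj₂ (l , h)) = inj₂ (last-++ʳ xs l , head-++ ys h)

  reverse-consec : ∀ {xs x y} → Consec xs x y → Consec (reverse xs) y x
  reverse-consec {x ∷ y ∷ xs} chere
    rewrite unfold-reverse x (y ∷ xs) | unfold-reverse y xs | ++-assoc (reverse xs) [ y ] [ x ]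
    = consec-++ʳ (reverse xs) chere
  reverse-consec {z ∷ xs} (cthere c) rewrite unfold-reverse z xs = consec-++ˡ [ z ] (reverse-consec c)

  reverse-head : ∀ {xs x} → Last xs x → Head (reverse xs) x
  reverse-head {x ∷ []} lhere = hhere
  reverse-head {y ∷ xs} (lthere l) rewrite unfold-reverse y xs = head-++ [ y ] (reverse-head l)

  reverse-last : ∀ {xs x} → Head xs x → Last (reverse xs) x
  reverse-last {x ∷ xs} hhere rewrite unfold-reverse x xs = last-snoc (reverse xs)

  reverse-consec⁻ : ∀ {xs x y} → Consec (reverse xs) x y → Consec xs y x
  reverse-consec⁻ {xs} {x} {y} c = subst (λ q → Consec q y x) (reverse-involutive xs) (reverse-consec c)

  reverse-head⁻ : ∀ {xs x} → Head (reverse xs) x → Last xs x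
  reverse-head⁻ {xs} {x} h = subst (λ q → Last q x) (reverse-involutive xs) (reverse-last h)

  reverse-last⁻ : ∀ {xs x} → Last (reverse xs) x → Head xs x
  reverse-last⁻ {xs} {x} l = subst (λ q → Head q x) (reverse-involutive xs) (reverse-head l)

  unique-++⁻ : ∀ (xs ys : List A) → Unique (xs ++ ys) → Unique xs × Unique ys × Disjoint xs ys
  unique-++⁻ [] ys u = [] , u , λ ()
  unique-++⁻ (x ∷ xs) ys (x∉ ∷ u) with unique-++⁻ xs ys u
  ... | uxs , uys , disj = All.tabulate (λ p → All.lookup x∉ (∈-++⁺ˡ p)) ∷ uxs , uys , disj′
    where
    disj′ : Disjoint (x ∷ xs) ys
    disj′ (here refl , q) = All.lookup x∉ (∈-++⁺ʳ xs q) refl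
    disj′ (there p , q) = disj (p , q)

  unique-swap : ∀ (xs ys : List A) → Unique (xs ++ ys) → Unique (ys ++ xs)
  unique-swap xs ys u with unique-++⁻ xs ys u
  ... | uxs , uys , disj = ++⁺ uys uxs (λ (p , q) → disj (q , p))

  unique-reverse : ∀ {xs : List A} → Unique xs → Unique (reverse xs)
  unique-reverse {[]} u = u
  unique-reverse {x ∷ xs} (x∉ ∷ u) rewrite unfold-reverse x xs =
    ++⁺ (unique-reverse u) (All.[] ∷ []) λ { (p , here refl) → All.lookup x∉ (Anyₚ.reverse⁻ p) refl }

  record Cut (cs : List A) (a b : A) : Set where
    field
      before after : List A
      split : cs ≡ before ++ after
      lastBefore : Last before a
      headNext : Head (after ++ before) b

  cut : ∀ {cs a b} → CycAdj cs a b → Cut cs a b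
  cut {cs} (inj₁ c) with go c
    where
    go : ∀ {cs a b} → Consec cs a b → ∃₂ λ X Y → cs ≡ X ++ Y × Last X a × Head Y b
    go {a ∷ b ∷ t} chere = [ a ] , b ∷ t , refl , lhere , hhere
    go {z ∷ t} (cthere c) with go c
    ... | X , Y , e , l , h = z ∷ X , Y , cong (z ∷_) e , lthere l , h
  ... | X , Y , e , l , h = record { before = X ; after = Y ; split = e ; lastBefore = l ; headNext = head-++ X h }
  cut {cs} (inj₂ (l , h)) = record { before = cs ; after = [] ; split = sym (++-identityʳ cs) ; lastBefore = l ; headNext = h }

  -- Splicing a nonempty list W (from a' to b') into the cut: the cyclic list
  -- before ++ W ++ after replaces the adjacency a → b by a → a', W, b' → b.
  module Splice {cs a b} (C : Cut cs a b) (W : List A) where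
    open Cut C

    spliced : List A
    spliced = before ++ W ++ after

    splice-old : ∀ {x y} → CycAdj cs x y → ¬ (x ≡ a × y ≡ b) → CycAdj spliced x y
    splice-old {x} {y} c ne = go before after (subst (λ q → CycAdj q x y) split c) lastBefore headNext
      where
      go : ∀ X Y → CycAdj (X ++ Y) x y → Last X a → Head (Y ++ X) b → CycAdj (X ++ W ++ Y) x y
      go X Y (inj₁ c) lX hYX with consec-++⁻ X Y c
      ... | inj₁ cX = inj₁ (consec-++ˡ (W ++ Y) cX)
      ... | inj₂ (inj₁ cY) = inj₁ (consec-++ʳ X (consec-++ʳ W cY))
      ... | inj₂ (inj₂ (l , h)) = ⊥-elim (ne (last-unique l lX , head-unique (head-++ X h) hYX))
      go (x0 ∷ X) [] (inj₂ (l , hhere)) lX hhere =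
        ⊥-elim (ne (last-unique (subst (λ q → Last q x) (++-identityʳ (x0 ∷ X)) l) lX , refl))
      go (x0 ∷ X) (y0 ∷ Y) (inj₂ (l , hhere)) lX hYX =
        inj₂ (subst (λ q → Last q x) (++-assoc (x0 ∷ X) W (y0 ∷ Y))
                (last-++ʳ ((x0 ∷ X) ++ W) (last-++⁻ (x0 ∷ X) hhere l)) , hhere)

    splice-new : ∀ {x y} → Consec W x y → CycAdj spliced x y
    splice-new c = inj₁ (consec-++ʳ before (consec-++ˡ after c))

    splice-adj⁻ : ∀ {a' b'} → Head W a' → Last W b' → ∀ {x y} → CycAdj spliced x y →
      CycAdj cs x y ⊎ (x ≡ a × y ≡ a') ⊎ (x ≡ b' × y ≡ b) ⊎ Consec W x y
    splice-adj⁻ {a'} {b'} hW lW {x} {y} c = go before after c lastBefore headNext split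
      where
      go : ∀ X Y → CycAdj (X ++ W ++ Y) x y → Last X a → Head (Y ++ X) b → cs ≡ X ++ Y →
        CycAdj cs x y ⊎ (x ≡ a × y ≡ a') ⊎ (x ≡ b' × y ≡ b) ⊎ Consec W x y
      go X Y (inj₁ c) lX hYX e with consec-++⁻ X (W ++ Y) c
      ... | inj₁ cX = inj₁ (inj₁ (subst (λ q → Consec q x y) (sym e) (consec-++ˡ Y cX)))
      ... | inj₂ (inj₂ (l , h)) = inj₂ (inj₁ (last-unique l lX , head-unique h (head-++ Y hW)))
      ... | inj₂ (inj₁ cWY) with consec-++⁻ W Y cWY
      ...   | inj₁ cW = inj₂ (inj₂ (inj₂ cW))
      ...   | inj₂ (inj₁ cY) = inj₁ (inj₁ (subst (λ q → Consec q x y) (sym e) (consec-++ʳ X cY)))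
      ...   | inj₂ (inj₂ (l , h)) = inj₂ (inj₂ (inj₁ (last-unique l lW , head-unique (head-++ X h) hYX)))
      go (x0 ∷ X) [] (inj₂ (l , hhere)) lX hYX e =
        inj₂ (inj₂ (inj₁ (last-unique (last-++⁻ (x0 ∷ X) hW l') lW , head-unique hhere hYX)))
        where
        l' : Last ((x0 ∷ X) ++ W) x
        l' = subst (λ q → Last q x) (trans (sym (++-assoc (x0 ∷ X) W [])) (++-identityʳ _)) l
      go (x0 ∷ X) (y0 ∷ Y) (inj₂ (l , hhere)) lX hYX e =
        inj₁ (subst (λ q → CycAdj q x y) (sym e)
          (inj₂ (last-++ʳ (x0 ∷ X) (last-++⁻ W hhere (last-++⁻ (x0 ∷ X) (head-++ _ hW) l)) , hhere)))

    splice-∈⁺ : ∀ {z} → z ∈ cs → z ∈ spliced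
    splice-∈⁺ q with ∈-++⁻ before (subst (_ ∈_) split q)
    ... | inj₁ q' = ∈-++⁺ˡ q'
    ... | inj₂ q' = ∈-++⁺ʳ before (∈-++⁺ʳ W q')

    splice-∈W : ∀ {z} → z ∈ W → z ∈ spliced
    splice-∈W q = ∈-++⁺ʳ before (∈-++⁺ˡ q)

    splice-∈⁻ : ∀ {z} → z ∈ spliced → z ∈ cs ⊎ z ∈ W
    splice-∈⁻ q with ∈-++⁻ before q
    ... | inj₁ q' = inj₁ (subst (_ ∈_) (sym split) (∈-++⁺ˡ q'))
    ... | inj₂ q' with ∈-++⁻ W q'
    ...   | inj₁ q″ = inj₂ q″
    ...   | inj₂ q″ = inj₁ (subst (_ ∈_) (sym split) (∈-++⁺ʳ before q″))

    splice-unique : Unique cs → Unique W → (∀ {z} → z ∈ W → z ∉ cs) → Unique spliced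
    splice-unique u uW fresh with unique-++⁻ before after (subst Unique split u)
    ... | u-before , u-after , disj =
      ++⁺ u-before (++⁺ uW u-after (λ (p , q) → fresh p (subst (_ ∈_) (sym split) (∈-++⁺ʳ before q)))) disj′
      where
      disj′ : Disjoint before (W ++ after)
      disj′ (p , q) with ∈-++⁻ W q
      ... | inj₁ qW = fresh qW (subst (_ ∈_) (sym split) (∈-++⁺ˡ p))
      ... | inj₂ qA = disj (p , qA)

    splice-length : length cs ≤ length spliced
    splice-length rewrite split | length-++ before {after} | length-++ before {W ++ after} | length-++ W {after}
      = ℕₚ.+-monoʳ-≤ (length before) (ℕₚ.m≤n+m (length after) (length W))

module _ {A B : Set} (f : A → B) where

  consec-map : ∀ {xs x y} → Consec xs x y → Consec (map f xs) (f x) (f y)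
  consec-map chere = chere
  consec-map (cthere c) = cthere (consec-map c)

  last-map : ∀ {xs x} → Last xs x → Last (map f xs) (f x)
  last-map lhere = lhere
  last-map (lthere l) = lthere (last-map l)

  head-map : ∀ {xs x} → Head xs x → Head (map f xs) (f x)
  head-map hhere = hhere

  consec-map⁻ : ∀ xs {a b} → Consec (map f xs) a b → ∃₂ λ x y → Consec xs x y × a ≡ f x × b ≡ f y
  consec-map⁻ (x ∷ y ∷ xs) chere = x , y , chere , refl , refl
  consec-map⁻ (x ∷ xs) (cthere c) with consec-map⁻ xs c
  ... | p , q , c' , e₁ , e₂ = p , q , cthere c' , e₁ , e₂

  last-map⁻ : ∀ xs {a} → Last (map f xs) a → ∃ λ x → Last xs x × a ≡ f x
  last-map⁻ (x ∷ []) lhere = x , lhere , refl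
  last-map⁻ (x ∷ xs) (lthere l) with last-map⁻ xs l
  ... | p , l' , e = p , lthere l' , e

  head-map⁻ : ∀ xs {a} → Head (map f xs) a → ∃ λ x → Head xs x × a ≡ f x
  head-map⁻ (x ∷ xs) hhere = x , hhere , refl

  cycAdj-map⁻ : ∀ xs {a b} → CycAdj (map f xs) a b → ∃₂ λ x y → CycAdj xs x y × a ≡ f x × b ≡ f y
  cycAdj-map⁻ xs (inj₁ c) with consec-map⁻ xs c
  ... | x , y , c' , e₁ , e₂ = x , y , inj₁ c' , e₁ , e₂
  cycAdj-map⁻ xs (inj₂ (l , h)) with last-map⁻ xs l | head-map⁻ xs h
  ... | x , lx , e₁ | y , hy , e₂ = x , y , inj₂ (lx , hy) , e₁ , e₂

_∈?_ : ∀ {N} (x : Fin N) (xs : List (Fin N)) → Dec (x ∈ xs)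
x ∈? xs = DecMembership._∈?_ _≟_ x xs

-- Counting.  ∣ tabulate p ∣ is the number of i : Fin N with p i ≡ true; it is
-- compared with lengths of lists by induction on N, removing the entry zero
-- from a list and shifting the other entries down by one.
shiftDown : ∀ {N} → List (Fin (suc N)) → List (Fin N)
shiftDown [] = []
shiftDown (zero ∷ ys) = shiftDown ys
shiftDown (suc j ∷ ys) = j ∷ shiftDown ys

module _ {N : ℕ} where

  shiftDown-∈⁻ : ∀ (ys : List (Fin (suc N))) {j} → j ∈ shiftDown ys → suc j ∈ ys
  shiftDown-∈⁻ (zero ∷ ys) q = there (shiftDown-∈⁻ ys q)
  shiftDown-∈⁻ (suc j ∷ ys) (here refl) = here refl
  shiftDown-∈⁻ (suc j ∷ ys) (there q) = there (shiftDown-∈⁻ ys q)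

  shiftDown-∈⁺ : ∀ (ys : List (Fin (suc N))) {j} → suc j ∈ ys → j ∈ shiftDown ys
  shiftDown-∈⁺ (zero ∷ ys) (there q) = shiftDown-∈⁺ ys q
  shiftDown-∈⁺ (suc j ∷ ys) (here refl) = here refl
  shiftDown-∈⁺ (suc j ∷ ys) (there q) = there (shiftDown-∈⁺ ys q)

  shiftDown-unique : ∀ (ys : List (Fin (suc N))) → Unique ys → Unique (shiftDown ys)
  shiftDown-unique [] _ = []
  shiftDown-unique (zero ∷ ys) (_ ∷ u) = shiftDown-unique ys u
  shiftDown-unique (suc j ∷ ys) (j∉ ∷ u) =
    All.tabulate (λ q e → All.lookup j∉ (shiftDown-∈⁻ ys q) (cong suc e)) ∷ shiftDown-unique ys u

  shiftDown-length : ∀ (ys : List (Fin (suc N))) → length (shiftDown ys) ≤ length ys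
  shiftDown-length [] = z≤n
  shiftDown-length (zero ∷ ys) = ℕₚ.m≤n⇒m≤1+n (shiftDown-length ys)
  shiftDown-length (suc j ∷ ys) = s≤s (shiftDown-length ys)

  shiftDown-length-zero : ∀ (ys : List (Fin (suc N))) → zero ∈ ys → suc (length (shiftDown ys)) ≤ length ys
  shiftDown-length-zero (zero ∷ ys) q = s≤s (shiftDown-length ys)
  shiftDown-length-zero (suc j ∷ ys) (there q) = s≤s (shiftDown-length-zero ys q)

  shiftDown-length-no-zero : ∀ (ys : List (Fin (suc N))) → zero ∉ ys → length ys ≤ length (shiftDown ys)
  shiftDown-length-no-zero [] _ = z≤n
  shiftDown-length-no-zero (zero ∷ ys) z∉ = ⊥-elim (z∉ (here refl))
  shiftDown-length-no-zero (suc j ∷ ys) z∉ = s≤s (shiftDown-length-no-zero ys (λ q → z∉ (there q)))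

  -- a duplicate-free list contains zero at most once
  shiftDown-length-unique : ∀ (ys : List (Fin (suc N))) → Unique ys → length ys ≤ suc (length (shiftDown ys))
  shiftDown-length-unique [] _ = z≤n
  shiftDown-length-unique (zero ∷ ys) u = s≤s (shiftDown-length-no-zero ys (Unique[x∷xs]⇒x∉xs u))
  shiftDown-length-unique (suc j ∷ ys) (_ ∷ u) = s≤s (shiftDown-length-unique ys u)

∣cons∣ : ∀ {N} b (v : Subset N) → ∣ b Vec.∷ v ∣ ≡ (if b then suc ∣ v ∣ else ∣ v ∣)
∣cons∣ true v = refl
∣cons∣ false v = refl

unique⇒length≤count : ∀ {N} (p : Fin N → Bool) (ys : List (Fin N)) → Unique ys →
  (∀ y → y ∈ ys → p y ≡ true) → length ys ≤ ∣ tabulate p ∣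
unique⇒length≤count {zero} p [] u sat = z≤n
unique⇒length≤count {suc N} p ys u sat
  with unique⇒length≤count (λ j → p (suc j)) (shiftDown ys) (shiftDown-unique ys u) (λ j q → sat (suc j) (shiftDown-∈⁻ ys q))
... | ih rewrite ∣cons∣ (p zero) (tabulate (λ j → p (suc j))) with p zero in eq
... | true = ℕₚ.≤-trans (shiftDown-length-unique ys u) (s≤s ih)
... | false = ℕₚ.≤-trans (shiftDown-length-no-zero ys zero∉) ih
  where
  zero∉ : zero ∉ ys
  zero∉ q with () ← trans (sym (sat zero q)) eq

count≤length : ∀ {N} (p : Fin N → Bool) (ys : List (Fin N)) →
  (∀ y → p y ≡ true → y ∈ ys) → ∣ tabulate p ∣ ≤ length ys
count≤length {zero} p ys cover = z≤n
count≤length {suc N} p ys cover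
  with count≤length (λ j → p (suc j)) (shiftDown ys) (λ j e → shiftDown-∈⁺ ys (cover (suc j) e))
... | ih rewrite ∣cons∣ (p zero) (tabulate (λ j → p (suc j))) with p zero in eq
... | true = ℕₚ.≤-trans (s≤s ih) (shiftDown-length-zero ys (cover zero eq))
... | false = ℕₚ.≤-trans ih (shiftDown-length ys)

∣full∣ : ∀ N → ∣ tabulate {n = N} (λ _ → true) ∣ ≡ N
∣full∣ zero = refl
∣full∣ (suc N) = cong suc (∣full∣ N)

unique⇒length≤ : ∀ {N} (ys : List (Fin N)) → Unique ys → length ys ≤ N
unique⇒length≤ {N} ys u = ℕₚ.≤-trans (unique⇒length≤count (λ _ → true) ys u (λ _ _ → refl)) (∣p∣≤n (tabulate (λ _ → true)))

missing : ∀ {k} (xs : List (Fin k)) → length xs < k → ∃ λ i → i ∉ xs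
missing {k} xs short with Finₚ.any? (λ i → ¬? (i ∈? xs))
... | yes found = found
... | no none = ⊥-elim (ℕₚ.<-irrefl refl (ℕₚ.<-≤-trans short (subst (_≤ length xs) (∣full∣ k) (count≤length _ xs cover))))
  where
  cover : ∀ y → true ≡ true → y ∈ xs
  cover y _ with y ∈? xs
  ... | yes q = q
  ... | no q = ⊥-elim (none (y , q))

remove : ∀ {N} → Fin N → List (Fin N) → List (Fin N)
remove z = filter (λ r → ¬? (r ≟ z))

module _ {N} {z : Fin N} where

  remove-∈⁻ : ∀ {r} xs → r ∈ remove z xs → r ∈ xs × r ≢ z
  remove-∈⁻ xs = ∈-filter⁻ (λ r → ¬? (r ≟ z)) {xs = xs}

  remove-length : ∀ xs → z ∈ xs → Unique xs → length xs ≡ suc (length (remove z xs))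
  remove-length (y ∷ xs) (here refl) (y∉ ∷ _) with y ≟ y
  ... | no y≢y = ⊥-elim (y≢y refl)
  ... | yes _ = cong suc (cong length (sym (filter-all (λ r → ¬? (r ≟ y)) (All.map (λ ne e → ne (sym e)) y∉))))
  remove-length (y ∷ xs) (there q) (y∉ ∷ u) with y ≟ z
  ... | yes refl = ⊥-elim (All.lookup y∉ q refl)
  ... | no _ = cong suc (remove-length xs q u)

Symmetric : ∀ {N} → Graph N → Set
Symmetric {N} G = ∀ (x y : Fin N) → G x y ≡ G y x

module _ {N : ℕ} {H : Graph N} where

  walk-++ : ∀ {a b c} → Walk H a b → Walk H b c → Walk H a c
  walk-++ [] w = w
  walk-++ (e ∷ w₁) w₂ = e ∷ walk-++ w₁ w₂

  walk-reverse : Symmetric H → ∀ {a b} → Walk H a b → Walk H b a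
  walk-reverse sym-H [] = []
  walk-reverse sym-H (_∷_ {u = u} {v = v} e w) = walk-++ (walk-reverse sym-H w) (trans (sym-H v u) e ∷ [])

  walk-along : Symmetric H → ∀ zs → (∀ a b → Consec zs a b → H a b ≡ true) →
    ∀ {a b} → a ∈ zs → b ∈ zs → Walk H a b
  walk-along sym-H (z ∷ zs) adj a∈ b∈ = walk-++ (walk-reverse sym-H (fromHead z zs adj a∈)) (fromHead z zs adj b∈)
    where
    fromHead : ∀ z zs → (∀ a b → Consec (z ∷ zs) a b → H a b ≡ true) → ∀ {x} → x ∈ z ∷ zs → Walk H z x
    fromHead z zs adj (here refl) = []
    fromHead z (z' ∷ zs) adj (there q) = adj z z' chere ∷ fromHead z' zs (λ a b c → adj a b (cthere c)) q

  chain-consec : ∀ zs → Chain H zs → ∀ {a b} → Consec zs a b → H a b ≡ true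
  chain-consec (x ∷ y ∷ zs) (e , _) chere = e
  chain-consec (x ∷ y ∷ zs) (_ , ch) (cthere c) = chain-consec (y ∷ zs) ch c

  consec⇒chain : ∀ zs → (∀ a b → Consec zs a b → H a b ≡ true) → Chain H zs
  consec⇒chain [] adj = _
  consec⇒chain (x ∷ []) adj = _
  consec⇒chain (x ∷ y ∷ zs) adj = adj x y chere , consec⇒chain (y ∷ zs) (λ a b c → adj a b (cthere c))

  cyclicChain-adj : ∀ xs → CyclicChain H xs → ∀ {a b} → CycAdj xs a b → H a b ≡ true
  cyclicChain-adj (x ∷ xs) ch (inj₁ c) = chain-consec (x ∷ xs ++ [ x ]) ch (consec-++ˡ [ x ] c)
  cyclicChain-adj (x ∷ xs) ch (inj₂ (l , hhere)) = chain-consec (x ∷ xs ++ [ x ]) ch (consec-join l hhere)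

  cycAdj⇒cyclicChain : ∀ xs → (∀ a b → CycAdj xs a b → H a b ≡ true) → CyclicChain H xs
  cycAdj⇒cyclicChain [] adj = _
  cycAdj⇒cyclicChain (x ∷ xs) adj = consec⇒chain (x ∷ xs ++ [ x ]) λ a b c → adj a b (closing c)
    where
    closing : ∀ {a b} → Consec ((x ∷ xs) ++ [ x ]) a b → CycAdj (x ∷ xs) a b
    closing c with consec-++⁻ (x ∷ xs) [ x ] c
    ... | inj₁ c' = inj₁ c'
    ... | inj₂ (inj₁ (cthere ()))
    ... | inj₂ (inj₂ (l , hhere)) = inj₂ (l , hhere)

-- Fix S and a list R of vertices outside S lying in pairwise different
-- components of G - S.  Cut the Hamiltonian cycle open right after a vertex
-- of S; along the resulting path zs every vertex of R is followed, before the
-- next vertex of S, only by vertices of its own component.  Charging each r ∈ R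
-- to the next vertex of S gives |R| ≤ |S|.  The induction along zs replaces a
-- representative by its successor whenever that successor is still outside S.
module Toughness {N : ℕ} (G : Graph N) (sym-G : Symmetric G) (S : Subset N) where

  inS : Fin N → Bool
  inS = Vec.lookup S

  D : Graph N
  D = delete G S

  sym-D : Symmetric D
  sym-D x y rewrite sym-G x y with inS x | inS y
  ... | true | true = refl
  ... | true | false = refl
  ... | false | true = refl
  ... | false | false = refl

  edge-D : ∀ {a b} → G a b ≡ true → inS a ≡ false → inS b ≡ false → D a b ≡ true
  edge-D e₁ e₂ e₃ rewrite e₁ | e₂ | e₃ = refl

  inS-cases : ∀ x → inS x ≡ false ⊎ inS x ≡ true
  inS-cases x with inS x
  ... | false = inj₁ refl
  ... | true = inj₂ refl

  edge-D⇒G : ∀ {a b} → D a b ≡ true → G a b ≡ true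
  edge-D⇒G {a} {b} e = ∧-conicalˡ (G a b) _ e

  edge-D⇒outside : ∀ {a b} → D a b ≡ true → inS b ≡ false
  edge-D⇒outside {a} {b} e with inS a | inS b | ∧-conicalʳ (G a b) _ e
  ... | false | false | _ = refl

  countS : List (Fin N) → ℕ
  countS zs = length (filter (λ z → inS z Bool.≟ true) zs)

  countS-in : ∀ {z} zs → inS z ≡ true → countS (z ∷ zs) ≡ suc (countS zs)
  countS-in zs e = cong length (filter-accept (λ z → inS z Bool.≟ true) e)

  countS-out : ∀ {z} zs → inS z ≡ false → countS (z ∷ zs) ≡ countS zs
  countS-out zs e = cong length (filter-reject (λ z → inS z Bool.≟ true) (false≢true e))

  countS-cons : ∀ z zs → countS zs ≤ countS (z ∷ zs)
  countS-cons z zs with inS z Bool.≟ true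
  ... | yes _ = ℕₚ.n≤1+n _
  ... | no _ = ℕₚ.≤-refl

  countS≤∣S∣ : ∀ zs → Unique zs → countS zs ≤ ∣ S ∣
  countS≤∣S∣ zs u = subst (countS zs ≤_) (cong ∣_∣ (tabulate∘lookup S))
    (unique⇒length≤count inS _ (filter⁺ _ u) (λ y q → proj₂ (∈-filter⁻ (λ z → inS z Bool.≟ true) {xs = zs} q)))

  record PathToS (zs : List (Fin N)) : Set where
    field
      unique : Unique zs
      adjacent : ∀ x y → Consec zs x y → G x y ≡ true
      endsInS : ∀ s → Last zs s → inS s ≡ true

  pathToS-tail : ∀ {z zs} → PathToS (z ∷ zs) → PathToS zs
  pathToS-tail P = record
    { unique = tailU unique
    ; adjacent = λ x y c → adjacent x y (cthere c)
    ; endsInS = λ s l → endsInS s (lthere l) }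
    where
    open PathToS P
    tailU : ∀ {z zs} → Unique (z ∷ zs) → Unique zs
    tailU (_ ∷ u) = u

  record Representatives (zs R : List (Fin N)) : Set where
    field
      unique : Unique R
      outside : ∀ r → r ∈ R → inS r ≡ false
      within : ∀ r → r ∈ R → r ∈ zs
      separated : ∀ a b → a ∈ R → b ∈ R → Walk D a b → a ≡ b

  reps-tail : ∀ {z zs R} → Representatives (z ∷ zs) R → z ∉ R → Representatives zs R
  reps-tail {R = R} reps z∉R = record { Representatives reps ; within = within′ }
    where
    open Representatives reps
    within′ : ∀ r → r ∈ R → r ∈ _
    within′ r q with within r q
    ... | here refl = ⊥-elim (z∉R q)
    ... | there q' = q'

  reps-shift : ∀ {z z' zs R} → Representatives (z ∷ z' ∷ zs) R → Unique (z ∷ z' ∷ zs) → z ∈ R →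
    G z z' ≡ true → inS z' ≡ false → Representatives (z' ∷ zs) (z' ∷ remove z R)
  reps-shift {z} {z'} {zs} {R} reps (z∉ ∷ _) z∈R g z'out = record
    { unique = All.tabulate (λ q e → z'∉R (subst (_∈ R) (sym e) (proj₁ (remove-∈⁻ R q)))) ∷ filter⁺ _ unique
    ; outside = outside′ ; within = within′ ; separated = separated′ }
    where
    open Representatives reps
    edge : D z z' ≡ true
    edge = edge-D g (outside z z∈R) z'out
    z'∉R : z' ∉ R
    z'∉R q = All.lookup z∉ (here refl) (separated z z' z∈R q (edge ∷ []))
    outside′ : ∀ r → r ∈ z' ∷ remove z R → inS r ≡ false
    outside′ r (here refl) = z'out
    outside′ r (there q) = outside r (proj₁ (remove-∈⁻ R q))
    within′ : ∀ r → r ∈ z' ∷ remove z R → r ∈ z' ∷ zs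
    within′ r (here refl) = here refl
    within′ r (there q) with remove-∈⁻ R q
    ... | r∈R , r≢z with within r r∈R
    ...   | here e = ⊥-elim (r≢z e)
    ...   | there q' = q'
    separated′ : ∀ a b → a ∈ z' ∷ remove z R → b ∈ z' ∷ remove z R → Walk D a b → a ≡ b
    separated′ a b (here refl) (here refl) w = refl
    separated′ a b (here refl) (there qb) w with remove-∈⁻ R qb
    ... | b∈R , b≢z = ⊥-elim (b≢z (sym (separated z b z∈R b∈R (edge ∷ w))))
    separated′ a b (there qa) (here refl) w with remove-∈⁻ R qa
    ... | a∈R , a≢z = ⊥-elim (a≢z (separated a z a∈R z∈R (walk-++ w (trans (sym-D z' z) edge ∷ []))))
    separated′ a b (there qa) (there qb) w = separated a b (proj₁ (remove-∈⁻ R qa)) (proj₁ (remove-∈⁻ R qb)) w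

  -- when the successor z' of the representative z lies in S, z is charged to z'
  reps-drop : ∀ {z z' zs R} → Representatives (z ∷ z' ∷ zs) R → inS z' ≡ true →
    Representatives zs (remove z R)
  reps-drop {z} {z'} {zs} {R} reps z'in = record
    { unique = filter⁺ _ unique
    ; outside = λ r q → outside r (proj₁ (remove-∈⁻ R q))
    ; within = within′
    ; separated = λ a b qa qb → separated a b (proj₁ (remove-∈⁻ R qa)) (proj₁ (remove-∈⁻ R qb)) }
    where
    open Representatives reps
    within′ : ∀ r → r ∈ remove z R → r ∈ zs
    within′ r q with remove-∈⁻ R q
    ... | r∈R , r≢z with within r r∈R
    ...   | here e = ⊥-elim (r≢z e)
    ...   | there (here refl) = ⊥-elim (false≢true (outside r r∈R) z'in)
    ...   | there (there q') = q'

  open ℕₚ.≤-Reasoning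

  charge-step : ∀ {z z' zs} → PathToS (z ∷ z' ∷ zs) → ∀ R → Representatives (z ∷ z' ∷ zs) R →
    (∀ R' → Representatives (z' ∷ zs) R' → length R' ≤ countS (z' ∷ zs)) →
    (∀ R' → Representatives zs R' → length R' ≤ countS zs) →
    length R ≤ countS (z ∷ z' ∷ zs)
  charge-step {z} {z'} {zs} P R reps ih₁ ih₂ with z ∈? R | inS-cases z'
  ... | no z∉R | _ = ℕₚ.≤-trans (ih₁ R (reps-tail reps z∉R)) (countS-cons z (z' ∷ zs))
  ... | yes z∈R | inj₁ z'out = begin
    length R                    ≡⟨ remove-length R z∈R (Representatives.unique reps) ⟩
    length (z' ∷ remove z R)    ≤⟨ ih₁ _ (reps-shift reps (PathToS.unique P) z∈R (PathToS.adjacent P z z' chere) z'out) ⟩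
    countS (z' ∷ zs)            ≡⟨ sym (countS-out (z' ∷ zs) (Representatives.outside reps z z∈R)) ⟩
    countS (z ∷ z' ∷ zs)        ∎
  ... | yes z∈R | inj₂ z'in = begin
    length R                    ≡⟨ remove-length R z∈R (Representatives.unique reps) ⟩
    suc (length (remove z R))   ≤⟨ s≤s (ih₂ _ (reps-drop reps z'in)) ⟩
    suc (countS zs)             ≡⟨ sym (countS-in zs z'in) ⟩
    countS (z' ∷ zs)            ≡⟨ sym (countS-out (z' ∷ zs) (Representatives.outside reps z z∈R)) ⟩
    countS (z ∷ z' ∷ zs)        ∎

  reps≤countS : ∀ zs → PathToS zs → ∀ R → Representatives zs R → length R ≤ countS zs
  reps≤countS [] P [] reps = z≤n
  reps≤countS [] P (r ∷ R) reps with () ← Representatives.within reps r (here refl)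
  reps≤countS (z ∷ []) P R reps with z ∈? R
  ... | no z∉R = ℕₚ.≤-trans (reps≤countS [] (pathToS-tail P) R (reps-tail reps z∉R)) (countS-cons z [])
  ... | yes z∈R = ⊥-elim (false≢true (Representatives.outside reps z z∈R) (PathToS.endsInS P z lhere))
  reps≤countS (z ∷ z' ∷ zs) P R reps =
    charge-step P R reps (reps≤countS (z' ∷ zs) (pathToS-tail P)) (reps≤countS zs (pathToS-tail (pathToS-tail P)))

  cycle-cut-at-S : ∀ {xs} → Unique xs → CyclicChain G xs → ∀ {s} → s ∈ xs → inS s ≡ true →
    ∃ λ zs → PathToS zs × (∀ v → v ∈ xs → v ∈ zs)
  cycle-cut-at-S {xs} uq cyc {s} s∈ s-in with ∈-∃++ s∈
  ... | pre , post , refl = post ++ pre ++ [ s ] , path , covers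
    where
    xs≡ : pre ++ s ∷ post ≡ (pre ++ [ s ]) ++ post
    xs≡ = sym (++-assoc pre [ s ] post)
    path : PathToS (post ++ pre ++ [ s ])
    path = record
      { unique = unique-swap (pre ++ [ s ]) post (subst Unique xs≡ uq)
      ; adjacent = λ x y c → cyclicChain-adj (pre ++ s ∷ post) cyc
                     (subst (λ q → CycAdj q x y) (sym xs≡) (rotate-consec (pre ++ [ s ]) post c))
      ; endsInS = λ s' l → subst (λ q → inS q ≡ true) (last-unique (last-++ʳ post (last-snoc pre)) l) s-in }
    covers : ∀ v → v ∈ pre ++ s ∷ post → v ∈ post ++ pre ++ [ s ]
    covers v q with ∈-++⁻ (pre ++ [ s ]) (subst (v ∈_) xs≡ q)
    ... | inj₁ q' = ∈-++⁺ʳ post q'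
    ... | inj₂ q' = ∈-++⁺ˡ q'

  cycle-avoiding-S : ∀ {xs} → CyclicChain G xs → (∀ v → v ∈ xs) →
    (∀ v → v ∈ xs → inS v ≡ false) → ∀ a b → Walk D a b
  cycle-avoiding-S {xs} cyc cover out a b = walk-along sym-D xs
    (λ x y c → edge-D (cyclicChain-adj xs cyc (inj₁ c)) (out x (consec-∈₁ c)) (out y (consec-∈₂ c)))
    (cover a) (cover b)

  -- The representatives of the k components form a list R to which the
  -- charging argument applies; a cycle avoiding S would make G - S connected.
  hamiltonian⇒tough : Hamiltonian G → ∀ k → NumComponents G S k → 2 ≤ k → k ≤ ∣ S ∣
  hamiltonian⇒tough (xs , uq , _ , cover , cyc) k@(suc (suc _)) (rep , repOut , apart , _) (s≤s (s≤s _))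
    with Any.any? (λ x → inS x Bool.≟ true) xs
  ... | no none = ⊥-elim (apart zero (suc zero) (λ ()) (cycle-avoiding-S cyc cover out _ _))
    where
    out : ∀ v → v ∈ xs → inS v ≡ false
    out v q with inS-cases v
    ... | inj₁ e = e
    ... | inj₂ e = ⊥-elim (none (Any.map (λ { refl → e }) q))
  ... | yes someS with find someS
  ...   | s , s∈ , s-in with cycle-cut-at-S uq cyc s∈ s-in
  ...     | zs , path , covers = begin
    k             ≡⟨ sym lengthR ⟩
    length R      ≤⟨ reps≤countS zs path R reps ⟩
    countS zs     ≤⟨ countS≤∣S∣ zs (PathToS.unique path) ⟩
    ∣ S ∣         ∎
    where
    R : List (Fin N)
    R = map rep (allFin k)
    lengthR : length R ≡ k
    lengthR = trans (length-map rep (allFin k)) (length-tabulate (λ i → i))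
    rep-injective : ∀ {i j} → rep i ≡ rep j → i ≡ j
    rep-injective {i} {j} e with i ≟ j
    ... | yes p = p
    ... | no i≢j = ⊥-elim (apart i j i≢j (subst (Walk D (rep i)) e []))
    reps : Representatives zs R
    reps = record
      { unique = map⁺ rep-injective (allFin⁺ k)
      ; outside = λ r q → case ∈-map⁻ rep q of λ { (i , _ , refl) → repOut i }
      ; within = λ r _ → covers r (cover r)
      ; separated = separated }
      where
      separated : ∀ a b → a ∈ R → b ∈ R → Walk D a b → a ≡ b
      separated a b qa qb w with ∈-map⁻ rep qa | ∈-map⁻ rep qb
      ... | i , _ , refl | j , _ , refl with i ≟ j
      ...   | yes refl = refl
      ...   | no i≢j = ⊥-elim (apart i j i≢j w)

hamiltonian⇒oneTough : ∀ {N} (G : Graph N) → Symmetric G → Hamiltonian G → OneTough G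
hamiltonian⇒oneTough G sym-G ham S = Toughness.hamiltonian⇒tough G sym-G S ham

PathGraph-sym : ∀ k → Symmetric (PathGraph k)
PathGraph-sym k a b = ∨-comm ⌊ toℕ a ℕ.≟ suc (toℕ b) ⌋ ⌊ toℕ b ℕ.≟ suc (toℕ a) ⌋

PathGraph-step : ∀ k (a b : Fin k) → toℕ b ≡ suc (toℕ a) → PathGraph k a b ≡ true
PathGraph-step k a b e rewrite ⌊≟⌋-yes ℕ._≟_ e = ∨-zeroʳ _

levels : (k : ℕ) → List (Fin (suc k))
levels zero = [ zero ]
levels (suc k) = zero ∷ map suc (levels k)

levels-complete : ∀ k (v : Fin (suc k)) → v ∈ levels k
levels-complete zero zero = here refl
levels-complete (suc k) zero = here refl
levels-complete (suc k) (suc v) = there (∈-map⁺ suc (levels-complete k v))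

levels-length : ∀ k → length (levels k) ≡ suc k
levels-length zero = refl
levels-length (suc k) = cong suc (trans (length-map suc (levels k)) (levels-length k))

levels-unique : ∀ k → Unique (levels k)
levels-unique zero = All.[] ∷ []
levels-unique (suc k) = All.tabulate zero∉ ∷ map⁺ suc-injective (levels-unique k)
  where
  zero∉ : ∀ {y} → y ∈ map suc (levels k) → zero ≢ y
  zero∉ q e with ∈-map⁻ suc q
  zero∉ q refl | _ , _ , ()

levels-head : ∀ k → Head (levels k) zero
levels-head zero = hhere
levels-head (suc k) = hhere

levels-last : ∀ k → Last (levels k) (fromℕ k)
levels-last zero = lhere
levels-last (suc k) = lthere (last-map suc (levels-last k))

levels-consec : ∀ k {a b} → Consec (levels k) a b → toℕ b ≡ suc (toℕ a)
levels-consec zero (cthere ())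
levels-consec (suc k) c with consec-++⁻ [ zero ] (map suc (levels k)) c
... | inj₁ (cthere ())
... | inj₂ (inj₁ c') with consec-map⁻ suc (levels k) c'
...   | x , y , c″ , refl , refl = cong suc (levels-consec k c″)
levels-consec (suc k) c | inj₂ (inj₂ (lhere , h)) with head-map⁻ suc (levels k) h
... | x , h' , refl with head-unique h' (levels-head k)
...   | refl = refl

levels-rung : ∀ k (i : Fin k) → Consec (levels k) (inject₁ i) (suc i)
levels-rung (suc zero) zero = chere
levels-rung (suc (suc k)) zero = chere
levels-rung (suc k) (suc i) = cthere (consec-map suc (levels-rung k i))

levels-split : ∀ k (i : Fin k) → ∃₂ λ L U → levels k ≡ L ++ U × Last L (inject₁ i) × Head U (suc i)
levels-split (suc k) zero = [ zero ] , map suc (levels k) , refl , lhere , head-map suc (levels-head k)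
levels-split (suc k) (suc i) with levels-split k i
... | L , U , e , l , h =
  zero ∷ map suc L , map suc U , cong (zero ∷_) (trans (cong (map suc) e) (map-++ suc L U)) ,
  lthere (last-map suc l) , head-map suc h

module PathProduct {m : ℕ} (T : Graph m) (n' : ℕ) where

  n : ℕ
  n = suc n'

  V : Set
  V = Fin n × Fin m

  G : Graph (n * m)
  G = PathGraph n □ T

  at : Fin m → Fin n → V
  at t v = v , t

  at-injective : ∀ {t x y} → at t x ≡ at t y → x ≡ y
  at-injective refl = refl

  enc : V → Fin (n * m)
  enc (v , t) = combine v t

  dec : Fin (n * m) → V
  dec = remQuot m

  dec-enc : ∀ p → dec (enc p) ≡ p
  dec-enc (v , t) = remQuot-combine v t

  enc-dec : ∀ g → enc (dec g) ≡ g
  enc-dec g = combine-remQuot {n} m g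

  enc-injective : ∀ {p q} → enc p ≡ enc q → p ≡ q
  enc-injective {p} {q} e = trans (sym (dec-enc p)) (trans (cong dec e) (dec-enc q))

  Adj : V → V → Bool
  Adj (v , t) (v' , t') = (⌊ v ≟ v' ⌋ ∧ T t t') ∨ (⌊ t ≟ t' ⌋ ∧ PathGraph n v v')

  G-enc : ∀ p q → G (enc p) (enc q) ≡ Adj p q
  G-enc p q = cong₂ Adj (dec-enc p) (dec-enc q)

  Adj-sym : Symmetric T → ∀ p q → Adj p q ≡ Adj q p
  Adj-sym sym-T (v , t) (v' , t')
    rewrite ⌊≟⌋-sym _≟_ v v' | sym-T t t' | ⌊≟⌋-sym _≟_ t t' | PathGraph-sym n v v' = refl

  G-sym : Symmetric T → Symmetric G
  G-sym sym-T x y = Adj-sym sym-T (dec x) (dec y)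

  row : ∀ v {t t'} → T t t' ≡ true → Adj (v , t) (v , t') ≡ true
  row v e rewrite ⌊≟⌋-yes _≟_ {v} refl | e = refl

  column : ∀ {v v'} t → toℕ v' ≡ suc (toℕ v) → Adj (v , t) (v' , t) ≡ true
  column {v} {v'} t e rewrite ⌊≟⌋-yes _≟_ {t} refl | PathGraph-step n v v' e = ∨-zeroʳ _

  column-along : ∀ {a b} → Consec (levels n') a b → ∀ t → Adj (a , t) (b , t) ≡ true
  column-along c t = column t (levels-consec n' c)

neighbours : ∀ {m} → Graph m → Fin m → List (Fin m)
neighbours {m} T u = filter (λ x → T u x Bool.≟ true) (allFin m)

module _ {m} (T : Graph m) (u : Fin m) where

  neighbours-unique : Unique (neighbours T u)
  neighbours-unique = filter⁺ _ (allFin⁺ m)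

  neighbours-adjacent : ∀ {x} → x ∈ neighbours T u → T u x ≡ true
  neighbours-adjacent q = proj₂ (∈-filter⁻ (λ x → T u x Bool.≟ true) {xs = allFin m} q)

  ∈-neighbours : ∀ {x} → T u x ≡ true → x ∈ neighbours T u
  ∈-neighbours e = ∈-filter⁺ (λ x → T u x Bool.≟ true) (∈-allFin _) e

  degree≤length : degree T u ≤ length (neighbours T u)
  degree≤length = count≤length (T u) _ (λ y e → ∈-neighbours e)

  distinct-neighbours≤degree : ∀ xs → Unique xs → (∀ x → x ∈ xs → T u x ≡ true) → length xs ≤ degree T u
  distinct-neighbours≤degree = unique⇒length≤count (T u)

degree≤maxDegree : ∀ {m} (T : Graph m) u → degree T u ≤ maxDegree T
degree≤maxDegree {m} T u = All.lookup below (∈-map⁺ (degree T) (∈-allFin u))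
  where
  below : All.All (_≤ maxDegree T) (map (degree T) (allFin m))
  below = foldr-forcesᵇ (λ x y le → ℕₚ.m⊔n≤o⇒m≤o x y le , ℕₚ.m⊔n≤o⇒n≤o x y le) 0 _ ℕₚ.≤-refl

maxDegree≤ : ∀ {m} (T : Graph m) {b} → (∀ u → degree T u ≤ b) → maxDegree T ≤ b
maxDegree≤ T {b} bound = foldr-preservesᵇ {P = _≤ b} ℕₚ.⊔-lub z≤n (All-map⁺ (tabulate⁺ bound))

lookup-injective : ∀ {A : Set} (xs : List A) → Unique xs → ∀ {i j} → List.lookup xs i ≡ List.lookup xs j → i ≡ j
lookup-injective (x ∷ xs) (x∉ ∷ u) {zero} {zero} e = refl
lookup-injective (x ∷ xs) (x∉ ∷ u) {zero} {suc j} e = ⊥-elim (All.lookup x∉ (∈-lookup j) e)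
lookup-injective (x ∷ xs) (x∉ ∷ u) {suc i} {zero} e = ⊥-elim (All.lookup x∉ (∈-lookup i) (sym e))
lookup-injective (x ∷ xs) (x∉ ∷ u) {suc i} {suc j} e = cong suc (lookup-injective xs u e)

walk⇒path : ∀ {m} {H : Graph m} (Q : Fin m → Set) → ∀ {x y} → Q x → (∀ a b → H a b ≡ true → Q b) → Walk H x y →
  Σ (List (Fin m)) λ ps → Unique ps × Head ps x × Last ps y × (∀ a b → Consec ps a b → H a b ≡ true) × (∀ z → z ∈ ps → Q z)
walk⇒path Q {x} qx step [] = [ x ] , All.[] ∷ [] , hhere , lhere , (λ { a b (cthere ()) }) , λ { z (here refl) → qx }
walk⇒path {H = H} Q {x} qx step (_∷_ {v = x'} e w) with walk⇒path Q (step _ _ e) step w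
... | ps , u , h , l , adj , all-Q with x ∈? ps
...   | yes x∈ps with ∈-∃++ x∈ps
...     | pre , post , refl =
  -- x already occurs on the path: drop the part before it
  x ∷ post , proj₁ (proj₂ (unique-++⁻ pre (x ∷ post) u)) , hhere , last-++⁻ pre hhere l ,
  (λ a b c → adj a b (consec-++ʳ pre c)) , (λ z q → all-Q z (∈-++⁺ʳ pre q))
walk⇒path {H = H} Q {x} qx step (_∷_ {v = x'} e w) | ps , u , h , l , adj , all-Q | no x∉ps =
  x ∷ ps , All.tabulate (λ q e' → x∉ps (subst (_∈ ps) (sym e') q)) ∷ u , hhere , lthere l , adj′ h adj , all-Q′
  where
  adj′ : ∀ {qs} → Head qs x' → (∀ a b → Consec qs a b → H a b ≡ true) → ∀ a b → Consec (x ∷ qs) a b → H a b ≡ true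
  adj′ hhere _ a b chere = e
  adj′ hhere adj a b (cthere c) = adj a b c
  all-Q′ : ∀ z → z ∈ x ∷ ps → Q z
  all-Q′ z (here refl) = qx
  all-Q′ z (there q) = all-Q z q

without : ∀ {m} → Graph m → Fin m → Graph m
without T u x y = T x y ∧ not ⌊ x ≟ u ⌋ ∧ not ⌊ y ≟ u ⌋

module _ {m} (T : Graph m) (u : Fin m) where

  without-edge : ∀ {a b} → T a b ≡ true → a ≢ u → b ≢ u → without T u a b ≡ true
  without-edge e a≢u b≢u rewrite e | ⌊≟⌋-no _≟_ a≢u | ⌊≟⌋-no _≟_ b≢u = refl

  without-⊆ : ∀ {a b} → without T u a b ≡ true → T a b ≡ true
  without-⊆ {a} {b} e = ∧-conicalˡ (T a b) _ e

  without-avoidsˡ : ∀ {a b} → without T u a b ≡ true → a ≢ u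
  without-avoidsˡ {a} {b} e refl rewrite ⌊≟⌋-yes _≟_ {u} refl with () ← ∧-conicalʳ (T u b) _ e

  without-avoidsʳ : ∀ {a b} → without T u a b ≡ true → b ≢ u
  without-avoidsʳ {a} {b} e refl rewrite ⌊≟⌋-yes _≟_ {u} refl with () ← ∧-conicalʳ (not ⌊ a ≟ u ⌋) false (∧-conicalʳ (T a u) _ e)

  last-exit : ∀ {a t} → Walk T a t → t ≢ u →
    (∃ λ x → T u x ≡ true × Walk (without T u) x t) ⊎ (a ≢ u × Walk (without T u) a t)
  last-exit [] t≢u = inj₂ (t≢u , [])
  last-exit {a} (_∷_ {v = a'} e w) t≢u with last-exit w t≢u
  ... | inj₁ exit = inj₁ exit
  ... | inj₂ (a'≢u , w') with a ≟ u
  ...   | yes refl = inj₁ (a' , e , w')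
  ...   | no a≢u = inj₂ (a≢u , without-edge e a≢u a'≢u ∷ w')

reach-avoiding : ∀ {m} {T : Graph m} → Connected T → ∀ {u t} → t ≢ u →
  ∃ λ x → T u x ≡ true × Walk (without T u) x t
reach-avoiding conn {u} {t} t≢u with last-exit _ u (conn u t) t≢u
... | inj₁ exit = exit
... | inj₂ (u≢u , _) = ⊥-elim (u≢u refl)

two-entries : ∀ {A : Set} (ps : List A) {x y} → Head ps x → Last ps y → x ≢ y → 2 ≤ length ps
two-entries (a ∷ []) hhere lhere x≢y = ⊥-elim (x≢y refl)
two-entries (a ∷ b ∷ ps) _ _ _ = s≤s (s≤s z≤n)

neighbour≢ : ∀ {m} {T : Graph m} → (∀ a → T a a ≡ false) → ∀ {u x} → T u x ≡ true → x ≢ u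
neighbour≢ loopless {u} ux refl = false≢true (loopless u) ux

-- In an acyclic graph, distinct neighbours x, y of u are not joined by a walk
-- avoiding u: such a walk contains a path, which closes to a cycle through u.
neighbours-separated : ∀ {m} {T : Graph m} → IsSimple T → Acyclic T → ∀ {u x y} →
  T u x ≡ true → T u y ≡ true → x ≢ y → ¬ Walk (without T u) x y
neighbours-separated {T = T} (sym-T , loopless) acyclic {u} {x} {y} ux uy x≢y w
  with walk⇒path (_≢ u) (neighbour≢ loopless ux) (λ a b e → without-avoidsʳ T u e) w
... | ps@(_ ∷ _) , ps-unique , ps-head@hhere , ps-last , ps-adjacent , ps-avoids =
  acyclic (u ∷ ps) (u∉ps ∷ ps-unique , s≤s (two-entries ps ps-head ps-last x≢y) , consec⇒chain _ closed)
  where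
  u∉ps : All.All (u ≢_) ps
  u∉ps = All.tabulate (λ q e → ps-avoids _ q (sym e))
  closed : ∀ a b → Consec (u ∷ ps ++ [ u ]) a b → T a b ≡ true
  closed a b chere = ux
  closed a b (cthere c) with consec-++⁻ ps [ u ] c
  ... | inj₁ c' = without-⊆ T u (ps-adjacent a b c')
  ... | inj₂ (inj₁ (cthere ()))
  ... | inj₂ (inj₂ (l , hhere)) rewrite last-unique l ps-last = trans (sym-T y u) uy

-- Deleting the column S = {v_u : v ∈ P_n} (|S| = n) leaves at least deg(u)
-- components: the vertices 0_x for the neighbours x of u are pairwise
-- separated (a walk between them projects to a walk of T - u), and every
-- other vertex v_t is joined to one of them (T is connected).
module ColumnCut {m} (T : Graph m) (simple : IsSimple T) (n' : ℕ) (u : Fin m) where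

  open PathProduct T n'

  S : Subset (n * m)
  S = tabulate (λ g → ⌊ proj₂ (dec g) ≟ u ⌋)

  open Toughness G (G-sym (proj₁ simple)) S using (inS; D; sym-D; edge-D; edge-D⇒G; edge-D⇒outside)

  inS-enc : ∀ v t → inS (enc (v , t)) ≡ ⌊ t ≟ u ⌋
  inS-enc v t = trans (lookup∘tabulate _ (enc (v , t))) (cong (λ p → ⌊ proj₂ p ≟ u ⌋) (dec-enc (v , t)))

  outside⇒≢ : ∀ g → inS g ≡ false → proj₂ (dec g) ≢ u
  outside⇒≢ g out e = false≢true (trans (sym (lookup∘tabulate _ g)) out) (⌊≟⌋-yes _≟_ e)

  outside-enc : ∀ v {t} → t ≢ u → inS (enc (v , t)) ≡ false
  outside-enc v {t} t≢u = trans (inS-enc v t) (⌊≟⌋-no _≟_ t≢u)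

  ∣S∣≤n : ∣ S ∣ ≤ n
  ∣S∣≤n = subst (∣ S ∣ ≤_) (trans (length-map _ (levels n')) (levels-length n')) (count≤length _ columnList cover)
    where
    columnList : List (Fin (n * m))
    columnList = map (λ v → enc (v , u)) (levels n')
    cover : ∀ g → ⌊ proj₂ (dec g) ≟ u ⌋ ≡ true → g ∈ columnList
    cover g e with proj₂ (dec g) ≟ u | enc-dec g
    ... | yes refl | g≡ = subst (_∈ columnList) g≡ (∈-map⁺ _ (levels-complete n' (proj₁ (dec g))))

  Adj-column : ∀ p q → Adj p q ≡ true → T (proj₂ p) (proj₂ q) ≡ true ⊎ proj₂ p ≡ proj₂ q
  Adj-column (v , t) (w , t') e with T t t' | t ≟ t'
  ... | true | _ = inj₁ refl
  ... | false | yes t≡t' = inj₂ t≡t'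
  ... | false | no _ rewrite ∧-zeroʳ ⌊ v ≟ w ⌋ with () ← e

  project : ∀ {g h} → Walk D g h → inS g ≡ false → Walk (without T u) (proj₂ (dec g)) (proj₂ (dec h))
  project [] _ = []
  project {g} (_∷_ {v = g'} e w) g-out with Adj-column (dec g) (dec g') (edge-D⇒G e)
  ... | inj₁ tree-edge =
    without-edge T u tree-edge (outside⇒≢ g g-out) (outside⇒≢ g' (edge-D⇒outside e)) ∷ project w (edge-D⇒outside e)
  ... | inj₂ same = subst (λ t → Walk (without T u) t _) (sym same) (project w (edge-D⇒outside e))

  lift-level0 : ∀ {a b} → Walk (without T u) a b → Walk D (enc (zero , a)) (enc (zero , b))
  lift-level0 [] = []
  lift-level0 (_∷_ {u = a} {v = a'} e w) =
    edge-D (trans (G-enc (zero , a) (zero , a')) (row zero (without-⊆ T u e)))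
           (outside-enc zero (without-avoidsˡ T u e)) (outside-enc zero (without-avoidsʳ T u e)) ∷ lift-level0 w

  lift-column : ∀ {t} → t ≢ u → ∀ v → Walk D (enc (zero , t)) (enc (v , t))
  lift-column {t} t≢u v = walk-along sym-D (map (λ z → enc (z , t)) (levels n')) adjacent
    (∈-map⁺ _ (levels-complete n' zero)) (∈-map⁺ _ (levels-complete n' v))
    where
    adjacent : ∀ a b → Consec (map (λ z → enc (z , t)) (levels n')) a b → D a b ≡ true
    adjacent a b c with consec-map⁻ (λ z → enc (z , t)) (levels n') c
    ... | p , q , c' , refl , refl =
      edge-D (trans (G-enc (p , t) (q , t)) (column-along c' t)) (outside-enc p t≢u) (outside-enc q t≢u)

  k : ℕ
  k = length (neighbours T u)

  neighbour : Fin k → Fin m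
  neighbour i = List.lookup (neighbours T u) i

  rep : Fin k → Fin (n * m)
  rep i = enc (zero , neighbour i)

  rep-outside : ∀ i → inS (rep i) ≡ false
  rep-outside i = outside-enc zero (neighbour≢ {T = T} (proj₂ simple) (neighbours-adjacent T u (∈-lookup i)))

  reps-separated : Acyclic T → ∀ i j → i ≢ j → ¬ Walk D (rep i) (rep j)
  reps-separated acyclic i j i≢j w =
    neighbours-separated simple acyclic (neighbours-adjacent T u (∈-lookup i)) (neighbours-adjacent T u (∈-lookup j))
      (λ e → i≢j (lookup-injective _ (neighbours-unique T u) e))
      (subst₂ (Walk (without T u)) (cong proj₂ (dec-enc (zero , neighbour i))) (cong proj₂ (dec-enc (zero , neighbour j))) (project w (rep-outside i)))

  reps-cover : Connected T → ∀ g → inS g ≡ false → ∃ λ i → Walk D (rep i) g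
  reps-cover conn g g-out with reach-avoiding conn (outside⇒≢ g g-out)
  ... | x , ux , w = i , subst (Walk D (rep i)) (enc-dec g) (walk-++ (lift-level0 w′) (lift-column (outside⇒≢ g g-out) (proj₁ (dec g))))
    where
    x∈ : x ∈ neighbours T u
    x∈ = ∈-neighbours T u ux
    i : Fin k
    i = Any.index x∈
    w′ : Walk (without T u) (neighbour i) (proj₂ (dec g))
    w′ = subst (λ y → Walk (without T u) y _) (Anyₚ.lookup-index x∈) w

  components : Acyclic T → Connected T → NumComponents G S k
  components acyclic conn = rep , rep-outside , reps-separated acyclic , reps-cover conn

  oneTough⇒degree≤ : Acyclic T → Connected T → OneTough G → degree T u ≤ n
  oneTough⇒degree≤ acyclic conn tough with k ℕ.≤? 1
  ... | yes k≤1 = ℕₚ.≤-trans (degree≤length T u) (ℕₚ.≤-trans k≤1 (s≤s z≤n))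
  ... | no k≰1 = begin
    degree T u   ≤⟨ degree≤length T u ⟩
    k            ≤⟨ tough S k (components acyclic conn) (ℕₚ.≰⇒> k≰1) ⟩
    ∣ S ∣        ≤⟨ ∣S∣≤n ⟩
    n            ∎
    where open ℕₚ.≤-Reasoning

oneTough⇒maxDegree≤ : ∀ {m} (T : Graph m) → IsSimple T → IsTree T → (n' : ℕ) →
  OneTough (PathGraph (suc n') □ T) → maxDegree T ≤ suc n'
oneTough⇒maxDegree≤ T simple (_ , conn , acyclic) n' tough =
  maxDegree≤ T (λ u → ColumnCut.oneTough⇒degree≤ T simple n' u acyclic conn tough)

-- For an edge w w' of T and a rung i (the P_n-edge between levels
-- i and i+1), the ladder is a Hamiltonian path of the two columns w, w' from
-- (i, w) to (i+1, w): down column w to level 0, across to w', up column w',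
-- across back to w and down to level i+1.  It uses every rung of column w'
-- and every rung of column w except i.
module Ladders {m : ℕ} (T : Graph m) (sym-T : Symmetric T) (n' : ℕ) where

  open PathProduct T n'

  lo hi : Fin n' → Fin n
  lo = inject₁
  hi = suc

  Linked : List V → V → V → Set
  Linked W x y = Consec W x y ⊎ Consec W y x

  column-along⁻ : ∀ {a b} → Consec (levels n') a b → ∀ t → Adj (b , t) (a , t) ≡ true
  column-along⁻ {a} {b} c t = trans (Adj-sym sym-T (b , t) (a , t)) (column-along c t)

  record Ladder (i : Fin n') (w w' : Fin m) (start end : V) : Set where
    field
      path : List V
      path-head : Head path start
      path-last : Last path end
      path-unique : Unique path
      path-adjacent : ∀ x y → Consec path x y → Adj x y ≡ true
      path-columns : ∀ {v t} → (v , t) ∈ path → t ≡ w ⊎ t ≡ w'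
      path-covers : ∀ v → (v , w) ∈ path × (v , w') ∈ path
      rungs : ∀ j → j ≢ i → Linked path (lo j , w) (hi j , w)
      rungs' : ∀ j → Linked path (lo j , w') (hi j , w')

  ladder-reverse : ∀ {i w w' a b} → Ladder i w w' a b → Ladder i w w' b a
  ladder-reverse L = record
    { path = reverse path
    ; path-head = reverse-head path-last
    ; path-last = reverse-last path-head
    ; path-unique = unique-reverse path-unique
    ; path-adjacent = λ x y c → trans (Adj-sym sym-T x y) (path-adjacent y x (reverse-consec⁻ c))
    ; path-columns = λ q → path-columns (Anyₚ.reverse⁻ q)
    ; path-covers = λ v → Anyₚ.reverse⁺ (proj₁ (path-covers v)) , Anyₚ.reverse⁺ (proj₂ (path-covers v))
    ; rungs = λ j j≢i → flip (rungs j j≢i)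
    ; rungs' = λ j → flip (rungs' j)
    }
    where
    open Ladder L
    flip : ∀ {x y} → Linked path x y → Linked (reverse path) x y
    flip (inj₁ c) = inj₂ (reverse-consec c)
    flip (inj₂ c) = inj₁ (reverse-consec c)

  module LadderConstruction (i : Fin n') (w w' : Fin m) (w≢w' : w ≢ w') (ww' : T w w' ≡ true) where

    split : ∃₂ λ L U → levels n' ≡ L ++ U × Last L (lo i) × Head U (hi i)
    split = levels-split n' i
    L U : List (Fin n)
    L = proj₁ split
    U = proj₁ (proj₂ split)
    levels≡ : levels n' ≡ L ++ U
    levels≡ = proj₁ (proj₂ (proj₂ split))
    L-last : Last L (lo i)
    L-last = proj₁ (proj₂ (proj₂ (proj₂ split)))
    U-head : Head U (hi i)
    U-head = proj₂ (proj₂ (proj₂ (proj₂ split)))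

    down up back : List V
    down = reverse (map (at w) L)
    up = map (at w') (levels n')
    back = reverse (map (at w) U)

    path : List V
    path = down ++ up ++ back

    LU-unique : Unique (L ++ U)
    LU-unique = subst Unique levels≡ (levels-unique n')

    in-levels : ∀ {a b} → Consec (L ++ U) a b → Consec (levels n') a b
    in-levels c = subst (λ q → Consec q _ _) (sym levels≡) c

    ∈-down : ∀ {z} → z ∈ down → ∃ λ x → x ∈ L × z ≡ at w x
    ∈-down q = ∈-map⁻ (at w) (Anyₚ.reverse⁻ q)

    ∈-up : ∀ {z} → z ∈ up → ∃ λ x → x ∈ levels n' × z ≡ at w' x
    ∈-up q = ∈-map⁻ (at w') q

    ∈-back : ∀ {z} → z ∈ back → ∃ λ x → x ∈ U × z ≡ at w x
    ∈-back q = ∈-map⁻ (at w) (Anyₚ.reverse⁻ q)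

    path-unique : Unique path
    path-unique = ++⁺ down-unique (++⁺ up-unique back-unique up#back) down#rest
      where
      down-unique : Unique down
      down-unique = unique-reverse (map⁺ at-injective (proj₁ (unique-++⁻ L U LU-unique)))
      up-unique : Unique up
      up-unique = map⁺ at-injective (levels-unique n')
      back-unique : Unique back
      back-unique = unique-reverse (map⁺ at-injective (proj₁ (proj₂ (unique-++⁻ L U LU-unique))))
      up#back : Disjoint up back
      up#back (p , q) with ∈-up p | ∈-back q
      ... | _ , _ , refl | _ , _ , e = w≢w' (sym (cong proj₂ e))
      down#rest : Disjoint down (up ++ back)
      down#rest (p , q) with ∈-++⁻ up q
      ... | inj₁ q-up with ∈-down p | ∈-up q-up
      ...   | _ , _ , refl | _ , _ , e = w≢w' (cong proj₂ e)
      down#rest (p , q) | inj₂ q-back with ∈-down p | ∈-back q-back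
      ...   | x , x∈L , refl | y , y∈U , e =
        proj₂ (proj₂ (unique-++⁻ L U LU-unique)) (x∈L , subst (_∈ U) (sym (cong proj₁ e)) y∈U)

    path-adjacent : ∀ x y → Consec path x y → Adj x y ≡ true
    path-adjacent x y c with consec-++⁻ down (up ++ back) c
    ... | inj₁ c-down with consec-map⁻ (at w) L (reverse-consec⁻ c-down)
    ...   | p , q , c' , refl , refl = column-along⁻ (in-levels (consec-++ˡ U c')) w
    path-adjacent x y c | inj₂ (inj₂ (l , h)) with head-map⁻ (at w) L (reverse-last⁻ l)
                                                  | head-unique h (head-++ back (head-map (at w') (levels-head n')))
    ... | p , hp , refl | refl with head-unique (subst (λ q → Head q p) (sym levels≡) (head-++ U hp)) (levels-head n')
    ...   | refl = row zero ww'
    path-adjacent x y c | inj₂ (inj₁ c-rest) with consec-++⁻ up back c-rest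
    ... | inj₁ c-up with consec-map⁻ (at w') (levels n') c-up
    ...   | p , q , c' , refl , refl = column-along c' w'
    path-adjacent x y c | inj₂ (inj₁ c-rest) | inj₂ (inj₁ c-back) with consec-map⁻ (at w) U (reverse-consec⁻ c-back)
    ...   | p , q , c' , refl , refl = column-along⁻ (in-levels (consec-++ʳ L c')) w
    path-adjacent x y c | inj₂ (inj₁ c-rest) | inj₂ (inj₂ (l , h)) with last-map⁻ (at w') (levels n') l
    ...   | p , lp , refl with last-map⁻ (at w) U (reverse-head⁻ h)
    ...     | q , lq , refl with last-unique lp (subst (λ r → Last r q) (sym levels≡) (last-++ʳ L lq))
    ...       | refl = row p (trans (sym-T w' w) ww')

    path-columns : ∀ {v t} → (v , t) ∈ path → t ≡ w ⊎ t ≡ w'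
    path-columns q with ∈-++⁻ down q
    ... | inj₁ q-down with ∈-down q-down
    ...   | _ , _ , refl = inj₁ refl
    path-columns q | inj₂ q-rest with ∈-++⁻ up q-rest
    ... | inj₁ q-up with ∈-up q-up
    ...   | _ , _ , refl = inj₂ refl
    path-columns q | inj₂ q-rest | inj₂ q-back with ∈-back q-back
    ...   | _ , _ , refl = inj₁ refl

    path-covers : ∀ v → (v , w) ∈ path × (v , w') ∈ path
    path-covers v = in-w , ∈-++⁺ʳ down (∈-++⁺ˡ (∈-map⁺ (at w') (levels-complete n' v)))
      where
      in-w : (v , w) ∈ path
      in-w with ∈-++⁻ L (subst (v ∈_) levels≡ (levels-complete n' v))
      ... | inj₁ v∈L = ∈-++⁺ˡ (Anyₚ.reverse⁺ (∈-map⁺ (at w) v∈L))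
      ... | inj₂ v∈U = ∈-++⁺ʳ down (∈-++⁺ʳ up (Anyₚ.reverse⁺ (∈-map⁺ (at w) v∈U)))

    rungs : ∀ j → j ≢ i → Linked path (lo j , w) (hi j , w)
    rungs j j≢i with consec-++⁻ L U (subst (λ q → Consec q _ _) levels≡ (levels-rung n' j))
    ... | inj₁ c-L = inj₂ (consec-++ˡ (up ++ back) (reverse-consec (consec-map (at w) c-L)))
    ... | inj₂ (inj₁ c-U) = inj₂ (consec-++ʳ down (consec-++ʳ up (reverse-consec (consec-map (at w) c-U))))
    ... | inj₂ (inj₂ (l , _)) = ⊥-elim (j≢i (inject₁-injective (last-unique l L-last)))

    ladder : Ladder i w w' (lo i , w) (hi i , w)
    ladder = record
      { path = path
      ; path-head = head-++ (up ++ back) (reverse-head (last-map (at w) L-last))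
      ; path-last = last-++ʳ down (last-++ʳ up (reverse-last (head-map (at w) U-head)))
      ; path-unique = path-unique
      ; path-adjacent = path-adjacent
      ; path-columns = path-columns
      ; path-covers = path-covers
      ; rungs = rungs
      ; rungs' = λ j → inj₁ (consec-++ʳ down (consec-++ˡ back (consec-map (at w') (levels-rung n' j))))
      }

rung-orientation : ∀ {n'} {i j : Fin n'} → inject₁ j ≡ suc i → suc j ≡ inject₁ i → ⊥
rung-orientation {i = i} {j} e₁ e₂ = ℕₚ.m≢1+n+m (toℕ j) {1} (begin
  toℕ j               ≡⟨ sym (toℕ-inject₁ j) ⟩
  toℕ (inject₁ j)     ≡⟨ cong toℕ e₁ ⟩
  suc (toℕ i)         ≡⟨ cong suc (sym (toℕ-inject₁ i)) ⟩
  suc (toℕ (inject₁ i)) ≡⟨ cong (λ x → suc (toℕ x)) (sym e₂) ⟩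
  suc (suc (toℕ j))   ∎)
  where open ≡-Reasoning

crossing-edge : ∀ {m} {T : Graph m} {cols : List (Fin m)} {a b} → Walk T a b → a ∈ cols → b ∉ cols →
  ∃₂ λ u w → u ∈ cols × w ∉ cols × T u w ≡ true
crossing-edge [] a∈ b∉ = ⊥-elim (b∉ a∈)
crossing-edge {cols = cols} (_∷_ {v = a'} e w) a∈ b∉ with a' ∈? cols
... | yes a'∈ = crossing-edge w a'∈ b∉
... | no a'∉ = _ , a' , a∈ , a'∉ , e

module Construction {m : ℕ} (T : Graph m) (simple : IsSimple T)
  (mate : Fin m → Fin m) (mate-adjacent : ∀ v → T v (mate v) ≡ true) (mate-involutive : ∀ v → mate (mate v) ≡ v)
  (n' : ℕ) (degree≤n : ∀ u → degree T u ≤ suc n') where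

  open PathProduct T n'
  open Ladders T (proj₁ simple) n'

  CycLinked : List V → V → V → Set
  CycLinked cs x y = CycAdj cs x y ⊎ CycAdj cs y x

  mate≢ : ∀ t → mate t ≢ t
  mate≢ t = neighbour≢ {T = T} (proj₂ simple) (mate-adjacent t)

  -- Every rung i of a column t is an edge of the cycle unless i ∈ used t; each
  -- used rung was spent on attaching a neighbour of t, so |used t| ≤ |attached t|,
  -- and the attached neighbours of t are distinct, covered and differ from mate t.
  record PartialCycle (cols : List (Fin m)) : Set where
    field
      cycle : List V
      cycle-unique : Unique cycle
      cycle-long : 2 ≤ length cycle
      cycle-adjacent : ∀ x y → CycAdj cycle x y → Adj x y ≡ true
      cycle-columns : ∀ {v t} → (v , t) ∈ cycle → t ∈ cols
      cycle-covers : ∀ v t → t ∈ cols → (v , t) ∈ cycle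
      cols-unique : Unique cols
      cols-mate : ∀ t → t ∈ cols → mate t ∈ cols
      used : Fin m → List (Fin n')
      attached : Fin m → List (Fin m)
      free-rung : ∀ t i → t ∈ cols → i ∉ used t → CycLinked cycle (lo i , t) (hi i , t)
      used≤attached : ∀ t → length (used t) ≤ length (attached t)
      attached-unique : ∀ t → Unique (attached t)
      attached-adjacent : ∀ t x → x ∈ attached t → T t x ≡ true
      attached-mate : ∀ t → mate t ∉ attached t
      attached-cols : ∀ t x → x ∈ attached t → x ∈ cols

  module Extend {cols : List (Fin m)} (P : PartialCycle cols) (u w : Fin m)
    (u∈ : u ∈ cols) (w∉ : w ∉ cols) (uw : T u w ≡ true) where

    open PartialCycle P

    w' : Fin m
    w' = mate w

    w'∉ : w' ∉ cols
    w'∉ q = w∉ (subst (_∈ cols) (mate-involutive w) (cols-mate w' q))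

    w≢w' : w ≢ w'
    w≢w' e = mate≢ w (sym e)

    new-columns : ∀ {t} → t ∈ cols → t ≢ w × t ≢ w'
    new-columns q = (λ { refl → w∉ q }) , (λ { refl → w'∉ q })

    -- w, mate u and the attached neighbours are distinct neighbours of u, so
    -- at most n - 2 rungs of u are used and one of the n - 1 rungs is free
    free-rung-exists : ∃ λ i → i ∉ used u
    free-rung-exists = missing (used u) (ℕₚ.≤-trans (s≤s (used≤attached u)) (ℕₚ.≤-pred bound))
      where
      nbs : List (Fin m)
      nbs = w ∷ mate u ∷ attached u
      nbs-unique : Unique nbs
      nbs-unique =
        All.tabulate (λ { (here refl) e → proj₁ (new-columns (cols-mate u u∈)) (sym e)
                        ; (there q) e → w∉ (attached-cols u w (subst (_∈ attached u) (sym e) q)) })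
        ∷ All.tabulate (λ q e → attached-mate u (subst (_∈ attached u) (sym e) q)) ∷ attached-unique u
      nbs-adjacent : ∀ x → x ∈ nbs → T u x ≡ true
      nbs-adjacent x (here refl) = uw
      nbs-adjacent x (there (here refl)) = mate-adjacent u
      nbs-adjacent x (there (there q)) = attached-adjacent u x q
      bound : suc (suc (length (attached u))) ≤ suc n'
      bound = ℕₚ.≤-trans (distinct-neighbours≤degree T u nbs nbs-unique nbs-adjacent) (degree≤n u)

    -- Replace the cycle edge a → b, which is rung i of column u, by the ladder
    -- of the columns w, w' from a' (next to a) to b' (next to b); the
    -- hypothesis only-rung-i says that a → b is no other rung of any column.
    module Insert (i : Fin n') (i∉ : i ∉ used u) {a b a' b' : V} (ab : CycAdj cycle a b)
      (L : Ladder i w w' a' b') (aa' : Adj a a' ≡ true) (b'b : Adj b' b ≡ true)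
      (only-rung-i : ∀ t j → (t ≡ u → j ≢ i) →
        ¬ ((lo j , t) ≡ a × (hi j , t) ≡ b) × ¬ ((hi j , t) ≡ a × (lo j , t) ≡ b)) where

      open Ladder L
      open Splice (cut ab) path

      cols′ : List (Fin m)
      cols′ = w ∷ w' ∷ cols

      -- the ladder avoids the old cycle, which lies in other columns
      fresh : ∀ {z} → z ∈ path → z ∉ cycle
      fresh {v , t} p q with path-columns p
      ... | inj₁ refl = w∉ (cycle-columns q)
      ... | inj₂ refl = w'∉ (cycle-columns q)

      adjacent′ : ∀ x y → CycAdj spliced x y → Adj x y ≡ true
      adjacent′ x y c with splice-adj⁻ path-head path-last c
      ... | inj₁ c-old = cycle-adjacent x y c-old
      ... | inj₂ (inj₁ (refl , refl)) = aa'
      ... | inj₂ (inj₂ (inj₁ (refl , refl))) = b'b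
      ... | inj₂ (inj₂ (inj₂ c-new)) = path-adjacent x y c-new

      old-rung : ∀ t j → (t ≡ u → j ≢ i) → CycLinked cycle (lo j , t) (hi j , t) → CycLinked spliced (lo j , t) (hi j , t)
      old-rung t j ok (inj₁ c) = inj₁ (splice-old c (proj₁ (only-rung-i t j ok)))
      old-rung t j ok (inj₂ c) = inj₂ (splice-old c (proj₂ (only-rung-i t j ok)))

      new-rung : ∀ {x y} → Linked path x y → CycLinked spliced x y
      new-rung (inj₁ c) = inj₁ (splice-new c)
      new-rung (inj₂ c) = inj₂ (splice-new c)

      -- bookkeeping: rung i is now used at u (attaching w) and at w (attaching u)
      data Role (t : Fin m) : Set where
        is-u : t ≡ u → Role t
        is-w : t ≢ u → t ≡ w → Role t
        other : t ≢ u → t ≢ w → Role t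

      role : ∀ t → Role t
      role t with t ≟ u | t ≟ w
      ... | yes t≡u | _ = is-u t≡u
      ... | no t≢u | yes t≡w = is-w t≢u t≡w
      ... | no t≢u | no t≢w = other t≢u t≢w

      used′ : Fin m → List (Fin n')
      used′ t with role t
      ... | is-u _ = i ∷ used u
      ... | is-w _ _ = [ i ]
      ... | other _ _ = used t

      attached′ : Fin m → List (Fin m)
      attached′ t with role t
      ... | is-u _ = w ∷ attached u
      ... | is-w _ _ = [ u ]
      ... | other _ _ = attached t

      u≢w : u ≢ w
      u≢w = proj₁ (new-columns u∈)

      u≢w' : u ≢ w'
      u≢w' = proj₂ (new-columns u∈)

      free-rung′ : ∀ t j → t ∈ cols′ → j ∉ used′ t → CycLinked spliced (lo j , t) (hi j , t)
      free-rung′ t j t∈ j∉ with role t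
      ... | is-u refl = old-rung u j (λ _ e → j∉ (here e)) (free-rung u j u∈ (λ q → j∉ (there q)))
      ... | is-w _ refl = new-rung (rungs j (λ e → j∉ (here e)))
      ... | other t≢u t≢w with t ≟ w'
      ...   | yes refl = new-rung (rungs' j)
      ...   | no t≢w' = old-rung t j (λ e → ⊥-elim (t≢u e)) (free-rung t j (old-col t∈) j∉)
        where
        old-col : t ∈ cols′ → t ∈ cols
        old-col (here e) = ⊥-elim (t≢w e)
        old-col (there (here e)) = ⊥-elim (t≢w' e)
        old-col (there (there q)) = q

      used≤attached′ : ∀ t → length (used′ t) ≤ length (attached′ t)
      used≤attached′ t with role t
      ... | is-u _ = s≤s (used≤attached u)
      ... | is-w _ _ = s≤s z≤n
      ... | other _ _ = used≤attached t

      attached-unique′ : ∀ t → Unique (attached′ t)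
      attached-unique′ t with role t
      ... | is-u _ = All.tabulate (λ q e → w∉ (attached-cols u w (subst (_∈ attached u) (sym e) q))) ∷ attached-unique u
      ... | is-w _ _ = All.[] ∷ []
      ... | other _ _ = attached-unique t

      attached-adjacent′ : ∀ t x → x ∈ attached′ t → T t x ≡ true
      attached-adjacent′ t x q with role t
      attached-adjacent′ t x (here refl) | is-u refl = uw
      attached-adjacent′ t x (there q) | is-u refl = attached-adjacent u x q
      attached-adjacent′ t x (here refl) | is-w _ refl = trans (proj₁ simple w u) uw
      attached-adjacent′ t x q | other _ _ = attached-adjacent t x q

      attached-mate′ : ∀ t → mate t ∉ attached′ t
      attached-mate′ t q with role t
      attached-mate′ t (here e) | is-u refl = proj₁ (new-columns (cols-mate u u∈)) e
      attached-mate′ t (there q) | is-u refl = attached-mate u q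
      attached-mate′ t (here e) | is-w _ refl = u≢w' (sym e)
      attached-mate′ t q | other _ _ = attached-mate t q

      attached-cols′ : ∀ t x → x ∈ attached′ t → x ∈ cols′
      attached-cols′ t x q with role t
      attached-cols′ t x (here refl) | is-u refl = here refl
      attached-cols′ t x (there q) | is-u refl = there (there (attached-cols u x q))
      attached-cols′ t x (here refl) | is-w _ refl = there (there u∈)
      attached-cols′ t x q | other _ _ = there (there (attached-cols t x q))

      columns′ : ∀ {v t} → (v , t) ∈ spliced → t ∈ cols′
      columns′ q with splice-∈⁻ q
      ... | inj₁ q-old = there (there (cycle-columns q-old))
      ... | inj₂ q-new with path-columns q-new
      ...   | inj₁ refl = here refl
      ...   | inj₂ refl = there (here refl)

      covers′ : ∀ v t → t ∈ cols′ → (v , t) ∈ spliced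
      covers′ v t (here refl) = splice-∈W (proj₁ (path-covers v))
      covers′ v t (there (here refl)) = splice-∈W (proj₂ (path-covers v))
      covers′ v t (there (there q)) = splice-∈⁺ (cycle-covers v t q)

      cols-unique′ : Unique cols′
      cols-unique′ =
        All.tabulate (λ { (here refl) e → w≢w' e ; (there q) e → w∉ (subst (_∈ cols) (sym e) q) })
        ∷ All.tabulate (λ q e → w'∉ (subst (_∈ cols) (sym e) q)) ∷ cols-unique

      cols-mate′ : ∀ t → t ∈ cols′ → mate t ∈ cols′
      cols-mate′ t (here refl) = there (here refl)
      cols-mate′ t (there (here refl)) = here (mate-involutive w)
      cols-mate′ t (there (there q)) = there (there (cols-mate t q))

      extended : PartialCycle cols′
      extended = record
        { cycle = spliced
        ; cycle-unique = splice-unique cycle-unique path-unique fresh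
        ; cycle-long = ℕₚ.≤-trans cycle-long splice-length
        ; cycle-adjacent = adjacent′
        ; cycle-columns = columns′
        ; cycle-covers = covers′
        ; cols-unique = cols-unique′
        ; cols-mate = cols-mate′
        ; used = used′
        ; attached = attached′
        ; free-rung = free-rung′
        ; used≤attached = used≤attached′
        ; attached-unique = attached-unique′
        ; attached-adjacent = attached-adjacent′
        ; attached-mate = attached-mate′
        ; attached-cols = attached-cols′
        }

    wu : T w u ≡ true
    wu = trans (proj₁ simple w u) uw

    ladder : ∀ {i} → Ladder i w w' (lo i , w) (hi i , w)
    ladder {i} = LadderConstruction.ladder i w w' w≢w' (mate-adjacent w)

    extend : PartialCycle (w ∷ w' ∷ cols)
    extend with free-rung-exists
    ... | i , i∉ with free-rung u i u∈ i∉
    ... | inj₁ forward =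
      Insert.extended i i∉ forward ladder (row (lo i) uw) (row (hi i) wu) only-rung
      where
      only-rung : ∀ t j → (t ≡ u → j ≢ i) →
        ¬ ((lo j , t) ≡ (lo i , u) × (hi j , t) ≡ (hi i , u)) × ¬ ((hi j , t) ≡ (lo i , u) × (lo j , t) ≡ (hi i , u))
      only-rung t j ok = (λ (e₁ , _) → ok (cong proj₂ e₁) (inject₁-injective (cong proj₁ e₁)))
                       , (λ (e₁ , e₂) → rung-orientation (cong proj₁ e₂) (cong proj₁ e₁))
    ... | inj₂ backward =
      Insert.extended i i∉ backward (ladder-reverse ladder) (row (hi i) uw) (row (lo i) wu) only-rung
      where
      only-rung : ∀ t j → (t ≡ u → j ≢ i) →
        ¬ ((lo j , t) ≡ (hi i , u) × (hi j , t) ≡ (lo i , u)) × ¬ ((hi j , t) ≡ (hi i , u) × (lo j , t) ≡ (lo i , u))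
      only-rung t j ok = (λ (e₁ , e₂) → rung-orientation (cong proj₁ e₁) (cong proj₁ e₂))
                       , (λ (e₁ , _) → ok (cong proj₂ e₁) (suc-injective (cong proj₁ e₁)))

  module Start (r : Fin m) where

    r' : Fin m
    r' = mate r

    up down : List V
    up = map (at r) (levels n')
    down = reverse (map (at r') (levels n'))

    cycle : List V
    cycle = up ++ down

    adjacent : ∀ x y → CycAdj cycle x y → Adj x y ≡ true
    adjacent x y (inj₁ c) with consec-++⁻ up down c
    ... | inj₁ c-up with consec-map⁻ (at r) (levels n') c-up
    ...   | p , q , c' , refl , refl = column-along c' r
    adjacent x y (inj₁ c) | inj₂ (inj₁ c-down) with consec-map⁻ (at r') (levels n') (reverse-consec⁻ c-down)
    ...   | p , q , c' , refl , refl = column-along⁻ c' r'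
    adjacent x y (inj₁ c) | inj₂ (inj₂ (l , h))
      with last-unique l (last-map (at r) (levels-last n'))
         | head-unique h (reverse-head (last-map (at r') (levels-last n')))
    ... | refl | refl = row (fromℕ n') (mate-adjacent r)
    adjacent x y (inj₂ (l , h))
      with last-unique (last-++⁻ up (reverse-head (last-map (at r') (levels-last n'))) l)
                       (reverse-last (head-map (at r') (levels-head n')))
         | head-unique h (head-++ down (head-map (at r) (levels-head n')))
    ... | refl | refl = row zero (trans (proj₁ simple r' r) (mate-adjacent r))

    column-of : ∀ {t z} → z ∈ map (at t) (levels n') → proj₂ z ≡ t
    column-of q with ∈-map⁻ _ q
    ... | _ , _ , refl = refl

    start : PartialCycle (r ∷ r' ∷ [])
    start = record
      { cycle = cycle
      ; cycle-unique = ++⁺ (map⁺ at-injective (levels-unique n')) (unique-reverse (map⁺ at-injective (levels-unique n')))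
                         (λ (p , q) → mate≢ r (trans (sym (column-of (Anyₚ.reverse⁻ q))) (column-of p)))
      ; cycle-long = long
      ; cycle-adjacent = adjacent
      ; cycle-columns = columns
      ; cycle-covers = covers
      ; cols-unique = All.tabulate (λ { (here refl) e → mate≢ r (sym e) }) ∷ All.[] ∷ []
      ; cols-mate = λ { t (here refl) → there (here refl) ; t (there (here refl)) → here (mate-involutive r) }
      ; used = λ _ → []
      ; attached = λ _ → []
      ; free-rung = free
      ; used≤attached = λ _ → z≤n
      ; attached-unique = λ _ → []
      ; attached-adjacent = λ _ _ ()
      ; attached-mate = λ _ ()
      ; attached-cols = λ _ _ ()
      }
      where
      long : 2 ≤ length cycle
      long rewrite length-++ up {down} | length-map (at r) (levels n') | length-reverse (map (at r') (levels n'))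
                 | length-map (at r') (levels n') | levels-length n' = s≤s (ℕₚ.≤-trans (s≤s z≤n) (ℕₚ.m≤n+m (suc n') n'))
      columns : ∀ {v t} → (v , t) ∈ cycle → t ∈ r ∷ r' ∷ []
      columns q with ∈-++⁻ up q
      ... | inj₁ q-up = here (column-of q-up)
      ... | inj₂ q-down = there (here (column-of (Anyₚ.reverse⁻ q-down)))
      covers : ∀ v t → t ∈ r ∷ r' ∷ [] → (v , t) ∈ cycle
      covers v t (here refl) = ∈-++⁺ˡ (∈-map⁺ (at r) (levels-complete n' v))
      covers v t (there (here refl)) = ∈-++⁺ʳ up (Anyₚ.reverse⁺ (∈-map⁺ (at r') (levels-complete n' v)))
      free : ∀ t i → t ∈ r ∷ r' ∷ [] → i ∉ [] → CycLinked cycle (lo i , t) (hi i , t)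
      free t i (here refl) _ = inj₁ (inj₁ (consec-++ˡ down (consec-map (at r) (levels-rung n' i))))
      free t i (there (here refl)) _ = inj₂ (inj₁ (consec-++ʳ up (reverse-consec (consec-map (at r') (levels-rung n' i)))))

  -- Each
  -- extension adds two columns, so `fuel` with m ≤ fuel + |cols| bounds the
  -- number of rounds; a missing column is reached from the covered ones along
  -- a walk of the connected tree, which crosses from cols to its complement.
  complete : Connected T → ∀ fuel {cols} → PartialCycle cols → ∀ {r} → r ∈ cols → m ≤ fuel + length cols →
    ∃ λ cols′ → PartialCycle cols′ × (∀ t → t ∈ cols′)
  complete conn fuel {cols} P r∈ bound with Finₚ.all? (_∈? cols)
  ... | yes all∈ = cols , P , all∈
  ... | no ¬all∈ with Finₚ.¬∀⟶∃¬ m (_∈ cols) (_∈? cols) ¬all∈ | fuel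
  ...   | x , x∉ | zero = ⊥-elim (ℕₚ.<-irrefl refl (ℕₚ.≤-trans too-many bound))
    where
    too-many : suc (length cols) ≤ m
    too-many = unique⇒length≤ (x ∷ cols)
      (All.tabulate (λ q e → x∉ (subst (_∈ cols) (sym e) q)) ∷ PartialCycle.cols-unique P)
  ...   | x , x∉ | suc fuel′ with crossing-edge (conn _ x) r∈ x∉
  ...     | u , w , u∈ , w∉ , uw =
    complete conn fuel′ (Extend.extend P u w u∈ w∉ uw) (there (there r∈))
      (ℕₚ.≤-trans bound (ℕₚ.≤-trans (ℕₚ.≤-reflexive (sym (ℕₚ.+-suc fuel′ _))) (ℕₚ.+-monoʳ-≤ fuel′ (ℕₚ.n≤1+n _))))

  hamiltonian : Connected T → 1 ≤ m → Hamiltonian G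
  hamiltonian conn 1≤m with complete conn m (Start.start (fromℕ< 1≤m)) (here refl) (ℕₚ.m≤m+n m _)
  ... | cols , P , all-columns =
    map enc cycle , map⁺ enc-injective cycle-unique , subst (2 ≤_) (sym (length-map enc cycle)) cycle-long ,
    covers , cycAdj⇒cyclicChain (map enc cycle) adjacent
    where
    open PartialCycle P
    covers : ∀ g → g ∈ map enc cycle
    covers g = subst (_∈ map enc cycle) (enc-dec g)
      (∈-map⁺ enc (cycle-covers (proj₁ (dec g)) (proj₂ (dec g)) (all-columns _)))
    adjacent : ∀ a b → CycAdj (map enc cycle) a b → G a b ≡ true
    adjacent a b c with cycAdj-map⁻ enc cycle c
    ... | p , q , c' , refl , refl = trans (G-enc p q) (cycle-adjacent p q c')

maxDegree≤⇒hamiltonian : ∀ {m} (T : Graph m) → IsSimple T → IsTree T → HasPerfectMatching T →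
  (n' : ℕ) → maxDegree T ≤ suc n' → Hamiltonian (PathGraph (suc n') □ T)
maxDegree≤⇒hamiltonian T simple (1≤m , conn , _) (mate , mate-adjacent , mate-involutive) n' Δ≤n =
  Construction.hamiltonian T simple mate mate-adjacent mate-involutive n'
    (λ u → ℕₚ.≤-trans (degree≤maxDegree T u) Δ≤n) conn 1≤m

corollary1p6 : ∀ {m} (T : Graph m) → IsSimple T → IsTree T → HasPerfectMatching T →
    (n : ℕ) → 1 ≤ n →
    (Hamiltonian (PathGraph n □ T) → OneTough (PathGraph n □ T))
    × (OneTough (PathGraph n □ T) → maxDegree T ≤ n)
    × (maxDegree T ≤ n → Hamiltonian (PathGraph n □ T))
corollary1p6 T simple tree matching (suc n') (s≤s z≤n) =
    hamiltonian⇒oneTough (PathGraph (suc n') □ T) (PathProduct.G-sym T n' (proj₁ simple))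
  , oneTough⇒maxDegree≤ T simple tree n'
  , maxDegree≤⇒hamiltonian T simple tree matching n'
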